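{- For every $i=2,\dots,n_0+n_1$, if $\mathrm{LCP}_{01}[i]=\ell$, then from the end of phase $\ell+1$ onward (i.e. at the end of every phase $h\ge\ell+1$) it holds that $B[i]=\ell+1$.
   Context: Strings: $T_0[1,n_0]$, $T_1[1,n_1]$ over a finite ordered alphabet $\Sigma$, with $T_0[n_0]=\$_0$, $T_1[n_1]=\$_1$, where $\$_0<\$_1$ occur nowhere else and are smaller than every other symbol. For a string $T[1,n]$: suffix array $\mathrm{SA}$ (lexicographic order of suffixes, a proper prefix being smaller), LCP array $\mathrm{LCP}[1,n+1]$ with $\mathrm{LCP}[i]$ the longest common prefix length of $T[\mathrm{SA}[i-1],n]$ and $T[\mathrm{SA}[i],n]$ for $2\le i\le n$ and $\mathrm{LCP}[1]=\mathrm{LCP}[n+1]=-1$; BWT $\mathrm{BWT}[i]=T[\mathrm{SA}[i]-1]$ if $\mathrm{SA}[i]>1$, else $T[n]$. $\mathrm{BWT}_\delta$ is the BWT of $T_\delta$ ($\delta=0,1$). $\mathrm{LCP}_{01}$ is the LCP array of the concatenation $T_0T_1$. Phases: $Z^{(0)}=0^{n_0}1^{n_1}$; $B[1,n_0+n_1+1]$ initialized with $B[1]=B[n_0+n_1+1]=1$ and other entries $0$. Phase $h\ge1$: set $F[c]=1+$(number of occurrences of symbols smaller than $c$ in $\mathrm{BWT}_0$ and $\mathrm{BWT}_1$), $\mathrm{Bid}[c]=-1$ for all symbols $c$, $k_0=k_1=1$; for $k=1,\dots,n_0+n_1$: if $B[k]\ne0$ and $B[k]\ne h$ set $id\gets k$;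 $b\gets Z^{(h-1)}[k]$; $c\gets\mathrm{BWT}_b[k_b]$ and increment $k_b$; $j\gets F[c]$ and increment $F[c]$; $Z^{(h)}[j]\gets b$; if $\mathrm{Bid}[c]\ne id$ then $\mathrm{Bid}[c]\gets id$ and, if $B[j]=0$, $B[j]\gets h$. -}

module Defs where

-- Symbols are natural numbers; $_0 is encoded as 0, $_1 as 1, and every
-- other symbol is >= 2. All arrays are 1-based functions ℕ → ℕ.

open import Data.Nat using (ℕ; zero; suc; _+_; _∸_; _≤_; _<_; _≡ᵇ_; _<ᵇ_)
open import Data.Bool using (Bool; true; false; if_then_else_; _∧_; _∨_; not)
open import Data.List using (List; []; _∷_; length; drop; _++_; map; filter; upTo)
open import Data.Maybe using (Maybe; just; nothing)
open import Data.Product using (_×_; _,_; proj₁; proj₂)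
open import Data.Nat using (_<?_)
open import Relation.Binary.PropositionalEquality using (_≡_)
open import Data.List.Relation.Binary.Lex.Strict using (Lex-<)

-- 1-based lookup T[i] (default 0 outside the range; never used there)
at : List ℕ → ℕ → ℕ
at []       _             = 0
at (x ∷ xs) zero          = 0
at (x ∷ xs) (suc zero)    = x
at (x ∷ xs) (suc (suc i)) = at xs (suc i)

suf : List ℕ → ℕ → List ℕ
suf T i = drop (i ∸ 1) T

_<lex_ : List ℕ → List ℕ → Set
xs <lex ys = Lex-< _≡_ _<_ xs ys

IsSA : List ℕ → (ℕ → ℕ) → Set
IsSA T sa =
  ((i : ℕ) → 1 ≤ i → i ≤ length T → (1 ≤ sa i) × (sa i ≤ length T)) ×
  ((i j : ℕ) → 1 ≤ i → i < j → j ≤ length T → suf T (sa i) <lex suf T (sa j))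

lcp : List ℕ → List ℕ → ℕ
lcp (x ∷ xs) (y ∷ ys) = if x ≡ᵇ y then suc (lcp xs ys) else 0
lcp _        _        = 0

-- LCP[i] for 2 ≤ i ≤ n, given the suffix array sa of T
LCP : List ℕ → (ℕ → ℕ) → ℕ → ℕ
LCP T sa i = lcp (suf T (sa (i ∸ 1))) (suf T (sa i))

BWT : List ℕ → (ℕ → ℕ) → ℕ → ℕ
BWT T sa i with sa i
... | suc (suc p) = at T (suc p)
... | _           = at T (length T)

upd : {A : Set} → (ℕ → A) → ℕ → A → (ℕ → A)
upd f i v x = if x ≡ᵇ i then v else f x

sameId : Maybe ℕ → ℕ → Bool
sameId nothing  _  = false
sameId (just a) id = a ≡ᵇ id

record St : Set where
  constructor st
  field
    cid : ℕ
    k0  : ℕ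
    k1  : ℕ
    F   : ℕ → ℕ
    Bid : ℕ → Maybe ℕ  -- nothing encodes -1
    Z   : ℕ → ℕ        -- Z^(h) being built
    B   : ℕ → ℕ

-- one iteration of the loop (index k) of phase h, reading Zprev = Z^(h-1)
step : (bwt0 bwt1 : ℕ → ℕ) → ℕ → (ℕ → ℕ) → ℕ → St → St
step bwt0 bwt1 h Zprev k (st id k0 k1 F Bid Z B) =
  let id' = if not (B k ≡ᵇ 0) ∧ not (B k ≡ᵇ h) then k else id
      b   = Zprev k
      c   = if b ≡ᵇ 0 then bwt0 k0 else bwt1 k1
      k0' = if b ≡ᵇ 0 then suc k0 else k0
      k1' = if b ≡ᵇ 0 then k1 else suc k1
      j   = F c
      F'  = upd F c (suc j)
      Z'  = upd Z j b
  in if sameId (Bid c) id'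
     then st id' k0' k1' F' Bid Z' B
     else st id' k0' k1' F' (upd Bid c (just id'))
             Z' (if B j ≡ᵇ 0 then upd B j h else B)

loop : (bwt0 bwt1 : ℕ → ℕ) → ℕ → (ℕ → ℕ) → (m k : ℕ) → St → St
loop bwt0 bwt1 h Zprev zero    k s = s
loop bwt0 bwt1 h Zprev (suc m) k s =
  loop bwt0 bwt1 h Zprev m (suc k) (step bwt0 bwt1 h Zprev k s)

countLess : ℕ → List ℕ → ℕ
countLess c xs = length (filter (λ x → x <? c) xs)

bwtList : List ℕ → (ℕ → ℕ) → List ℕ
bwtList T sa = map (λ i → BWT T sa (suc i)) (upTo (length T))

-- (Z^(h), B at the end of phase h); h = 0 gives the initial values.
-- The variable id is initialised to 0 (any value different from -1).
phases : (T0 T1 : List ℕ) (sa0 sa1 : ℕ → ℕ) → ℕ → (ℕ → ℕ) × (ℕ → ℕ)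
phases T0 T1 sa0 sa1 zero =
  (λ k → if k ≤ᵇ' length T0 then 0 else 1) ,
  (λ k → if (k ≡ᵇ 1) ∨ (k ≡ᵇ suc N) then 1 else 0)
  where
    N = length T0 + length T1
    _≤ᵇ'_ : ℕ → ℕ → Bool
    a ≤ᵇ' b = a <ᵇ suc b
phases T0 T1 sa0 sa1 (suc h) =
  let prev = phases T0 T1 sa0 sa1 h
      b0   = bwtList T0 sa0
      b1   = bwtList T1 sa1
      F0   = λ c → suc (countLess c b0 + countLess c b1)
      s    = loop (BWT T0 sa0) (BWT T1 sa1) (suc h) (proj₁ prev)
                  (length T0 + length T1) 1
                  (st 0 1 1 F0 (λ _ → nothing) (λ _ → 0) (proj₂ prev))
  in St.Z s , St.B s

Bafter : (T0 T1 : List ℕ) (sa0 sa1 : ℕ → ℕ) → ℕ → ℕ → ℕ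
Bafter T0 T1 sa0 sa1 h = proj₂ (phases T0 T1 sa0 sa1 h)

module Submission where

open import Defs
open import Data.Nat
open import Data.Nat.Properties
open import Data.Bool using (Bool; true; false; T; if_then_else_; _∧_; _∨_; not)
open import Data.Bool.Properties using (∧-comm; ∧-identityʳ; ∧-zeroʳ; not-involutive)
open import Data.List using (List; []; _∷_; [_]; length; _++_; drop; map; applyUpTo)
open import Data.List.Properties using (length-++; ++-assoc; length-drop)
import Data.List.Relation.Binary.Lex.Core as Lex
open import Data.List.Relation.Unary.All using (All; []; _∷_)
open import Data.Maybe using (Maybe; just; nothing)
open import Data.Product using (∃; _×_; _,_; proj₁; proj₂)
open import Data.Sum using (_⊎_; inj₁; inj₂; [_,_]′)
open import Data.Empty using (⊥-elim)
open import Function using (_∘_)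
open import Relation.Nullary using (¬_; yes; no)
open import Relation.Binary.Definitions using (tri<; tri≈; tri>)
open import Relation.Binary.PropositionalEquality hiding ([_])
open import Algebra.Properties.CommutativeSemigroup +-commutativeSemigroup using (interchange)

-- Phase h lists in Z^(h) the suffixes of T₀ and T₁ sorted by their first h
-- symbols, ties broken by text (T₀ first) and then by the order within each
-- text; phase h+1 derives this order from that of phase h by the LF mapping,
-- reading the preceding symbols off the two BWTs. Hence index j of Z^(h) holds
-- a suffix sharing h symbols with the j-th suffix of T₀T₁, and two iterations
-- of phase h+1 run under the same id exactly when the suffixes they process
-- share h symbols. By induction on h, after phase h every 2 ≤ j ≤ N has
-- B[j] = LCP₀₁[j] + 1 if LCP₀₁[j] < h and B[j] = 0 otherwise: in phase h+1 an
-- entry still 0 is set precisely when the suffixes at j-1 and j share h but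
-- not h+1 symbols.

≡ᵇ-refl : ∀ n → (n ≡ᵇ n) ≡ true
≡ᵇ-refl zero    = refl
≡ᵇ-refl (suc n) = ≡ᵇ-refl n

≡ᵇ≡true⇒≡ : ∀ m n → (m ≡ᵇ n) ≡ true → m ≡ n
≡ᵇ≡true⇒≡ m n e = ≡ᵇ⇒≡ m n (subst T (sym e) _)

≡⇒≡ᵇ≡true : ∀ {m n} → m ≡ n → (m ≡ᵇ n) ≡ true
≡⇒≡ᵇ≡true {m} refl = ≡ᵇ-refl m

≢⇒≡ᵇ≡false : ∀ {m n} → m ≢ n → (m ≡ᵇ n) ≡ false
≢⇒≡ᵇ≡false {m} {n} m≢n with m ≡ᵇ n in e
... | false = refl
... | true  = ⊥-elim (m≢n (≡ᵇ≡true⇒≡ m n e))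

data ≡ᵇ-Cases (m n : ℕ) : Set where
  equal   : (m ≡ᵇ n) ≡ true  → m ≡ n → ≡ᵇ-Cases m n
  unequal : (m ≡ᵇ n) ≡ false → m ≢ n → ≡ᵇ-Cases m n

≡ᵇ-cases : ∀ m n → ≡ᵇ-Cases m n
≡ᵇ-cases m n with m ≡ᵇ n in e
... | true  = equal e (≡ᵇ≡true⇒≡ m n e)
... | false = unequal e (λ m≡n → subst T e (≡⇒≡ᵇ m n m≡n))

<ᵇ≡true⇒< : ∀ m n → (m <ᵇ n) ≡ true → m < n
<ᵇ≡true⇒< m n e = <ᵇ⇒< m n (subst T (sym e) _)

<⇒<ᵇ≡true : ∀ {m n} → m < n → (m <ᵇ n) ≡ true
<⇒<ᵇ≡true {m} {n} m<n with m <ᵇ n in e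
... | true  = refl
... | false = ⊥-elim (subst T e (<⇒<ᵇ m<n))

≥⇒<ᵇ≡false : ∀ {m n} → n ≤ m → (m <ᵇ n) ≡ false
≥⇒<ᵇ≡false {m} {n} n≤m with m <ᵇ n in e
... | false = refl
... | true  = ⊥-elim (<⇒≱ (<ᵇ≡true⇒< m n e) n≤m)

<ᵇ≡false⇒≥ : ∀ m n → (m <ᵇ n) ≡ false → n ≤ m
<ᵇ≡false⇒≥ m n e with <-≤-connex m n
... | inj₁ m<n = ⊥-elim (subst T e (<⇒<ᵇ m<n))
... | inj₂ n≤m = n≤m

if-true : ∀ {A : Set} {b} {x y : A} → b ≡ true → (if b then x else y) ≡ x
if-true refl = refl

if-false : ∀ {A : Set} {b} {x y : A} → b ≡ false → (if b then x else y) ≡ y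
if-false refl = refl

at-or-away : ∀ {P : ℕ → Set} i → P i → (∀ x → x ≢ i → P x) → ∀ x → P x
at-or-away i at-i away x with x ≟ i
... | yes refl = at-i
... | no  x≢i  = away x x≢i

infix 4 _∈[1,_]

_∈[1,_] : ℕ → ℕ → Set
i ∈[1, n ] = 1 ≤ i × i ≤ n

∈-weaken : ∀ {n i} → i ∈[1, n ] → i ∈[1, suc n ]
∈-weaken (1≤i , i≤n) = 1≤i , m≤n⇒m≤1+n i≤n

∈-top : ∀ n → suc n ∈[1, suc n ]
∈-top n = s≤s z≤n , ≤-refl

∈-below-top : ∀ {n i} → i ∈[1, suc n ] → i ≢ suc n → i ∈[1, n ]
∈-below-top (1≤i , i≤1+n) i≢1+n = 1≤i , ≤-pred (≤∧≢⇒< i≤1+n i≢1+n)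

∈-empty : ∀ {i} → ¬ i ∈[1, 0 ]
∈-empty (1≤i , i≤0) with () ← ≤-trans 1≤i i≤0

bit : Bool → ℕ
bit true  = 1
bit false = 0

bit-if-suc : ∀ x a → (if x then suc a else a) ≡ bit x + a
bit-if-suc true  a = refl
bit-if-suc false a = refl

bit-if-suc-not : ∀ x a → (if x then a else suc a) ≡ bit (not x) + a
bit-if-suc-not true  a = refl
bit-if-suc-not false a = refl

count : ℕ → (ℕ → Bool) → ℕ
count zero    P = 0
count (suc n) P = bit (P (suc n)) + count n P

count-cong : ∀ n P Q → (∀ i → i ∈[1, n ] → P i ≡ Q i) → count n P ≡ count n Q
count-cong zero    P Q P≗Q = refl
count-cong (suc n) P Q P≗Q =
  cong₂ _+_ (cong bit (P≗Q (suc n) (∈-top n))) (count-cong n P Q (λ i → P≗Q i ∘ ∈-weaken))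

bit-mono : ∀ a b → (a ≡ true → b ≡ true) → bit a ≤ bit b
bit-mono true  b a⇒b rewrite a⇒b refl = ≤-refl
bit-mono false b a⇒b = z≤n

count-mono : ∀ n P Q → (∀ i → i ∈[1, n ] → P i ≡ true → Q i ≡ true) → count n P ≤ count n Q
count-mono zero    P Q P⇒Q = z≤n
count-mono (suc n) P Q P⇒Q =
  +-mono-≤ (bit-mono _ _ (P⇒Q (suc n) (∈-top n))) (count-mono n P Q (λ i → P⇒Q i ∘ ∈-weaken))

count-mono-< : ∀ n P Q → (∀ i → i ∈[1, n ] → P i ≡ true → Q i ≡ true) →
  ∀ x → x ∈[1, n ] → P x ≡ false → Q x ≡ true → count n P < count n Q
count-mono-< zero    P Q P⇒Q x x∈ = ⊥-elim (∈-empty x∈)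
count-mono-< (suc n) P Q P⇒Q x x∈ Px Qx with ≡ᵇ-cases x (suc n)
... | equal _ refl rewrite Px | Qx = s≤s (count-mono n P Q (λ i → P⇒Q i ∘ ∈-weaken))
... | unequal _ x≢ =
  +-mono-≤-< (bit-mono _ _ (P⇒Q (suc n) (∈-top n)))
             (count-mono-< n P Q (λ i → P⇒Q i ∘ ∈-weaken) x (∈-below-top x∈ x≢) Px Qx)

count-none : ∀ n P → (∀ i → i ∈[1, n ] → P i ≡ false) → count n P ≡ 0
count-none zero    P ¬P = refl
count-none (suc n) P ¬P rewrite ¬P (suc n) (∈-top n) = count-none n P (λ i → ¬P i ∘ ∈-weaken)

count-all : ∀ n P → (∀ i → i ∈[1, n ] → P i ≡ true) → count n P ≡ n
count-all zero    P allP = refl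
count-all (suc n) P allP rewrite allP (suc n) (∈-top n) =
  cong suc (count-all n P (λ i → allP i ∘ ∈-weaken))

count-< : ∀ n P x → x ∈[1, n ] → P x ≡ false → count n P < n
count-< n P x x∈ Px =
  subst (count n P <_) (count-all n _ (λ _ _ → refl))
        (count-mono-< n P (λ _ → true) (λ _ _ _ → refl) x x∈ Px refl)

bit-∧-split : ∀ a b → bit a ≡ bit (a ∧ b) + bit (a ∧ not b)
bit-∧-split true  true  = refl
bit-∧-split true  false = refl
bit-∧-split false b     = refl

count-split : ∀ n (P Q : ℕ → Bool) →
  count n P ≡ count n (λ i → P i ∧ Q i) + count n (λ i → P i ∧ not (Q i))
count-split zero    P Q = refl
count-split (suc n) P Q
  rewrite count-split n P Q | bit-∧-split (P (suc n)) (Q (suc n)) =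
    interchange (bit (P (suc n) ∧ Q (suc n))) (bit (P (suc n) ∧ not (Q (suc n)))) _ _

count-+ : ∀ a b P → count (a + b) P ≡ count a P + count b (λ i → P (a + i))
count-+ a zero    P rewrite +-identityʳ a = sym (+-identityʳ _)
count-+ a (suc b) P rewrite +-suc a b | count-+ a b P =
  trans (sym (+-assoc (bit (P (suc (a + b)))) (count a P) _))
    (trans (cong (_+ count b (λ i → P (a + i))) (+-comm (bit (P (suc (a + b)))) (count a P)))
      (+-assoc (count a P) _ _))

count-≡ᵇ : ∀ n y → y ∈[1, n ] → count n (_≡ᵇ y) ≡ 1
count-≡ᵇ zero    y y∈ = ⊥-elim (∈-empty y∈)
count-≡ᵇ (suc n) y y∈ with ≡ᵇ-cases (suc n) y
... | equal e refl rewrite e =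
  cong suc (count-none n _ (λ i i∈ → ≢⇒≡ᵇ≡false (<⇒≢ (s≤s (proj₂ i∈)))))
... | unequal e 1+n≢y rewrite e = count-≡ᵇ n y (∈-below-top y∈ (1+n≢y ∘ sym))

count>0⇒∃ : ∀ n P → 0 < count n P → ∃ λ i → i ∈[1, n ] × P i ≡ true
count>0⇒∃ (suc n) P pos with P (suc n) in e
... | true  = suc n , ∈-top n , e
... | false with i , i∈ , Pi ← count>0⇒∃ n P pos = i , ∈-weaken i∈ , Pi

count-prefix : ∀ n k P → k ≤ suc n → count n (λ i → (i <ᵇ k) ∧ P i) ≡ count (k ∸ 1) P
count-prefix zero    zero          P _ = refl
count-prefix zero    (suc zero)    P _ = refl
count-prefix zero    (suc (suc k)) P (s≤s ())
count-prefix (suc n) k P k≤ with m≤n⇒m<n∨m≡n k≤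
... | inj₂ refl = count-cong (suc n) _ P (λ i i∈ → cong (_∧ P i) (<⇒<ᵇ≡true (s≤s (proj₂ i∈))))
... | inj₁ k<   rewrite ≥⇒<ᵇ≡false {suc n} {k} (≤-pred k<) = count-prefix n k P (≤-pred k<)

count-<ᵇ : ∀ n r → r ≤ suc n → count n (_<ᵇ r) ≡ r ∸ 1
count-<ᵇ n r r≤ =
  trans (count-cong n _ _ (λ i _ → sym (∧-identityʳ (i <ᵇ r))))
        (trans (count-prefix n r _ r≤) (count-all (r ∸ 1) _ (λ _ _ → refl)))

IsSelfMap : ℕ → (ℕ → ℕ) → Set
IsSelfMap n f = ∀ i → i ∈[1, n ] → f i ∈[1, n ]

IsInjectiveOn : ℕ → (ℕ → ℕ) → Set
IsInjectiveOn n f = ∀ i j → i ∈[1, n ] → j ∈[1, n ] → f i ≡ f j → i ≡ j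

count-≤-injection : ∀ n m P Q (g : ℕ → ℕ) →
  (∀ i → i ∈[1, n ] → P i ≡ true → g i ∈[1, m ] × Q (g i) ≡ true) →
  (∀ i j → i ∈[1, n ] → j ∈[1, n ] → P i ≡ true → P j ≡ true → g i ≡ g j → i ≡ j) →
  count n P ≤ count m Q
count-≤-injection zero    m P Q g into inj = z≤n
count-≤-injection (suc n) m P Q g into inj with P (suc n) in e
... | false =
  count-≤-injection n m P Q g (λ i → into i ∘ ∈-weaken) (λ i j i∈ j∈ → inj i j (∈-weaken i∈) (∈-weaken j∈))
... | true = begin
    suc (count n P)
      ≤⟨ s≤s (count-≤-injection n m P Q-y g into-Q-y inj-below) ⟩
    suc (count m Q-y)
      ≡⟨ cong (_+ count m Q-y) (trans (count-cong m _ _ Q-at-y) (count-≡ᵇ m y y∈)) ⟨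
    count m (λ z → Q z ∧ (z ≡ᵇ y)) + count m Q-y
      ≡⟨ count-split m Q (_≡ᵇ y) ⟨
    count m Q ∎
  where
  open ≤-Reasoning
  y = g (suc n)
  y∈ = proj₁ (into (suc n) (∈-top n) e)
  Q-y = λ z → Q z ∧ not (z ≡ᵇ y)
  Q-at-y : ∀ z → z ∈[1, m ] → (Q z ∧ (z ≡ᵇ y)) ≡ (z ≡ᵇ y)
  Q-at-y z _ with ≡ᵇ-cases z y
  ... | equal   z≡ᵇy refl rewrite z≡ᵇy = trans (∧-identityʳ (Q z)) (proj₂ (into (suc n) (∈-top n) e))
  ... | unequal z≢ᵇy _    rewrite z≢ᵇy = ∧-zeroʳ (Q z)
  into-Q-y : ∀ i → i ∈[1, n ] → P i ≡ true → g i ∈[1, m ] × Q-y (g i) ≡ true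
  into-Q-y i i∈ Pi with into i (∈-weaken i∈) Pi
  ... | gi∈ , Qgi = gi∈ , cong₂ (λ a b → a ∧ not b) Qgi (≢⇒≡ᵇ≡false gi≢y)
    where
    gi≢y : g i ≢ y
    gi≢y gi≡y = <⇒≢ (s≤s (proj₂ i∈)) (inj i (suc n) (∈-weaken i∈) (∈-top n) Pi e gi≡y)
  inj-below : ∀ i j → i ∈[1, n ] → j ∈[1, n ] → P i ≡ true → P j ≡ true → g i ≡ g j → i ≡ j
  inj-below i j i∈ j∈ = inj i j (∈-weaken i∈) (∈-weaken j∈)

≤-≤-+-≡⇒≡ : ∀ {a b c d} → a ≤ c → b ≤ d → a + b ≡ c + d → a ≡ c
≤-≤-+-≡⇒≡ {a} {b} {c} {d} a≤c b≤d sum≡ =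
  ≤-antisym a≤c (+-cancelʳ-≤ d c a (≤-trans (≤-reflexive (sym sum≡)) (+-monoʳ-≤ a b≤d)))

module _ {n : ℕ} {f : ℕ → ℕ} (f-maps : IsSelfMap n f) (f-inj : IsInjectiveOn n f) where

  -- Counting is monotone along an injection, both for P and for not ∘ P, and
  -- the two counts add up to n on either side.
  count-∘-permutation : ∀ P → count n (P ∘ f) ≡ count n P
  count-∘-permutation P = ≤-≤-+-≡⇒≡ (≤-along-f P) (≤-along-f (not ∘ P))
    (begin
      count n (P ∘ f) + count n (not ∘ P ∘ f) ≡⟨ count-split n _ (P ∘ f) ⟨
      count n (λ _ → true)                    ≡⟨ count-split n _ P ⟩
      count n P + count n (not ∘ P)           ∎)
    where
    open ≡-Reasoning
    ≤-along-f : ∀ P → count n (P ∘ f) ≤ count n P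
    ≤-along-f P = count-≤-injection n n (P ∘ f) P f (λ i i∈ Pfi → f-maps i i∈ , Pfi)
                                     (λ i j i∈ j∈ _ _ → f-inj i j i∈ j∈)

  permutation-surjective : ∀ y → y ∈[1, n ] → ∃ λ i → i ∈[1, n ] × f i ≡ y
  permutation-surjective y y∈ with count>0⇒∃ n (λ i → f i ≡ᵇ y) one-preimage
    where one-preimage = ≤-reflexive (sym (trans (count-∘-permutation (_≡ᵇ y)) (count-≡ᵇ n y y∈)))
  ... | i , i∈ , fi≡ᵇy = i , i∈ , ≡ᵇ≡true⇒≡ (f i) y fi≡ᵇy

  search : ℕ → ℕ → ℕ
  search zero    y = 0
  search (suc m) y = if f (suc m) ≡ᵇ y then suc m else search m y

  search-correct : ∀ m y → (∃ λ i → i ∈[1, m ] × f i ≡ y) → search m y ∈[1, m ] × f (search m y) ≡ y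
  search-correct zero    y (i , i∈ , _) = ⊥-elim (∈-empty i∈)
  search-correct (suc m) y (i , i∈ , fi≡y) with ≡ᵇ-cases (f (suc m)) y
  ... | equal   e f1+m≡y rewrite e = ∈-top m , f1+m≡y
  ... | unequal e f1+m≢y rewrite e
    with search-correct m y (i , ∈-below-top i∈ (λ { refl → f1+m≢y fi≡y }) , fi≡y)
  ...   | s∈ , fs≡y = ∈-weaken s∈ , fs≡y

  f⁻¹ : ℕ → ℕ
  f⁻¹ = search n

  f⁻¹-maps : ∀ y → y ∈[1, n ] → f⁻¹ y ∈[1, n ]
  f⁻¹-maps y y∈ = proj₁ (search-correct n y (permutation-surjective y y∈))

  f∘f⁻¹ : ∀ y → y ∈[1, n ] → f (f⁻¹ y) ≡ y
  f∘f⁻¹ y y∈ = proj₂ (search-correct n y (permutation-surjective y y∈))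

  f⁻¹∘f : ∀ i → i ∈[1, n ] → f⁻¹ (f i) ≡ i
  f⁻¹∘f i i∈ = f-inj _ i (f⁻¹-maps (f i) (f-maps i i∈)) i∈ (f∘f⁻¹ (f i) (f-maps i i∈))

-- Lexicographic order and longest common prefixes

infix 4 _<lexᵇ_

_<lexᵇ_ : List ℕ → List ℕ → Bool
[]       <lexᵇ []       = false
[]       <lexᵇ (_ ∷ _)  = true
(_ ∷ _)  <lexᵇ []       = false
(x ∷ xs) <lexᵇ (y ∷ ys) = if x ≡ᵇ y then xs <lexᵇ ys else x <ᵇ y

<lex⇒<lexᵇ : ∀ xs ys → xs <lex ys → (xs <lexᵇ ys) ≡ true
<lex⇒<lexᵇ []       []       (Lex.base ())
<lex⇒<lexᵇ []       (y ∷ ys) Lex.halt          = refl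
<lex⇒<lexᵇ (x ∷ xs) (y ∷ ys) (Lex.this x<y)    rewrite ≢⇒≡ᵇ≡false (<⇒≢ x<y) = <⇒<ᵇ≡true x<y
<lex⇒<lexᵇ (x ∷ xs) (y ∷ ys) (Lex.next refl r) rewrite ≡ᵇ-refl x = <lex⇒<lexᵇ xs ys r

<lexᵇ-irrefl : ∀ xs → (xs <lexᵇ xs) ≡ false
<lexᵇ-irrefl []       = refl
<lexᵇ-irrefl (x ∷ xs) rewrite ≡ᵇ-refl x = <lexᵇ-irrefl xs

<lexᵇ-∷-≢ : ∀ {c d} xs ys → c ≢ d → (c ∷ xs <lexᵇ d ∷ ys) ≡ (c <ᵇ d)
<lexᵇ-∷-≢ xs ys c≢d rewrite ≢⇒≡ᵇ≡false c≢d = refl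

lcp-∷ : ∀ c xs ys → lcp (c ∷ xs) (c ∷ ys) ≡ suc (lcp xs ys)
lcp-∷ c xs ys rewrite ≡ᵇ-refl c = refl

lcp-∷-≢ : ∀ {c d} xs ys → c ≢ d → lcp (c ∷ xs) (d ∷ ys) ≡ 0
lcp-∷-≢ xs ys c≢d rewrite ≢⇒≡ᵇ≡false c≢d = refl

<lexᵇ-trans : ∀ xs ys zs → (xs <lexᵇ ys) ≡ true → (ys <lexᵇ zs) ≡ true → (xs <lexᵇ zs) ≡ true
<lexᵇ-trans []       (y ∷ ys) (z ∷ zs) _  _  = refl
<lexᵇ-trans []       []       zs       () _
<lexᵇ-trans (x ∷ xs) []       zs       () _
<lexᵇ-trans xs       (y ∷ ys) []       _  ()
<lexᵇ-trans (x ∷ xs) (y ∷ ys) (z ∷ zs) p q with ≡ᵇ-cases x y | ≡ᵇ-cases y z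
... | equal e₁ refl | equal _ refl rewrite e₁ = <lexᵇ-trans xs ys zs p q
... | equal e₁ refl | unequal e₂ _ rewrite e₁ | e₂ = q
... | unequal e₁ _  | equal e₂ refl rewrite e₁ | e₂ = p
... | unequal e₁ _  | unequal e₂ _ rewrite e₁ | e₂ with x<z ← <-trans (<ᵇ≡true⇒< x y p) (<ᵇ≡true⇒< y z q)
  rewrite ≢⇒≡ᵇ≡false (<⇒≢ x<z) = <⇒<ᵇ≡true x<z

<lexᵇ-asym : ∀ xs ys → (xs <lexᵇ ys) ≡ true → (ys <lexᵇ xs) ≡ false
<lexᵇ-asym xs ys p with ys <lexᵇ xs in q
... | false = refl
... | true  with () ← trans (sym (<lexᵇ-irrefl xs)) (<lexᵇ-trans xs ys xs p q)

<lexᵇ-total : ∀ xs ys → xs ≢ ys → (xs <lexᵇ ys) ≡ true ⊎ (ys <lexᵇ xs) ≡ true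
<lexᵇ-total []       []       xs≢ys = ⊥-elim (xs≢ys refl)
<lexᵇ-total []       (y ∷ ys) _     = inj₁ refl
<lexᵇ-total (x ∷ xs) []       _     = inj₂ refl
<lexᵇ-total (x ∷ xs) (y ∷ ys) xs≢ys with ≡ᵇ-cases x y
... | equal e refl rewrite e = <lexᵇ-total xs ys (λ xs≡ys → xs≢ys (cong (x ∷_) xs≡ys))
... | unequal _ x≢y rewrite <lexᵇ-∷-≢ xs ys x≢y | <lexᵇ-∷-≢ ys xs (λ y≡x → x≢y (sym y≡x))
  with <-cmp x y
...   | tri< x<y _ _ = inj₁ (<⇒<ᵇ≡true x<y)
...   | tri≈ _ x≡y _ = ⊥-elim (x≢y x≡y)
...   | tri> _ _ y<x = inj₂ (<⇒<ᵇ≡true y<x)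

lcp-comm : ∀ xs ys → lcp xs ys ≡ lcp ys xs
lcp-comm []       []       = refl
lcp-comm []       (y ∷ ys) = refl
lcp-comm (x ∷ xs) []       = refl
lcp-comm (x ∷ xs) (y ∷ ys) with ≡ᵇ-cases x y
... | equal e refl rewrite e = cong suc (lcp-comm xs ys)
... | unequal _ x≢y rewrite lcp-∷-≢ xs ys x≢y | lcp-∷-≢ ys xs (λ y≡x → x≢y (sym y≡x)) = refl

lcp-≥-trans : ∀ H xs ys zs → H ≤ lcp xs ys → H ≤ lcp ys zs → H ≤ lcp xs zs
lcp-≥-trans zero    xs       ys       zs       _ _ = z≤n
lcp-≥-trans (suc H) []       ys       zs       () _
lcp-≥-trans (suc H) (x ∷ xs) []       zs       () _
lcp-≥-trans (suc H) (x ∷ xs) (y ∷ ys) []       _ ()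
lcp-≥-trans (suc H) (x ∷ xs) (y ∷ ys) (z ∷ zs) p q with ≡ᵇ-cases x y | ≡ᵇ-cases y z
... | equal e₁ refl | equal _ refl rewrite e₁ = s≤s (lcp-≥-trans H xs ys zs (≤-pred p) (≤-pred q))
... | equal _  refl | unequal e₂ _ rewrite e₂ with () ← q
... | unequal e₁ _  | _            rewrite e₁ with () ← p

lcp-<-transferʳ : ∀ zs ys xs → lcp ys xs < lcp zs ys →
  lcp zs xs ≡ lcp ys xs × (zs <lexᵇ xs) ≡ (ys <lexᵇ xs)
lcp-<-transferʳ []       ys       xs       ()
lcp-<-transferʳ (z ∷ zs) []       xs       ()
lcp-<-transferʳ (z ∷ zs) (y ∷ ys) []       _ = refl , refl
lcp-<-transferʳ (z ∷ zs) (y ∷ ys) (x ∷ xs) lt with ≡ᵇ-cases z y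
... | unequal e _ rewrite e with () ← lt
... | equal _ refl with ≡ᵇ-cases z x
...   | unequal e _ rewrite e = refl , refl
...   | equal e refl rewrite e | ≡ᵇ-refl z with lcp-<-transferʳ zs ys xs (≤-pred lt)
...     | lcp≡ , <≡ = cong suc lcp≡ , <≡

lcp-<-transferˡ : ∀ xs ys zs → lcp xs ys < lcp ys zs →
  lcp xs zs ≡ lcp xs ys × (xs <lexᵇ zs) ≡ (xs <lexᵇ ys)
lcp-<-transferˡ xs       []       zs       ()
lcp-<-transferˡ xs       (y ∷ ys) []       ()
lcp-<-transferˡ []       (y ∷ ys) (z ∷ zs) _ = refl , refl
lcp-<-transferˡ (x ∷ xs) (y ∷ ys) (z ∷ zs) lt with ≡ᵇ-cases y z
... | unequal e _ rewrite e with () ← lt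
... | equal _ refl with ≡ᵇ-cases x y
...   | unequal e _ rewrite e = refl , refl
...   | equal e refl rewrite e | ≡ᵇ-refl x with lcp-<-transferˡ xs ys zs (≤-pred lt)
...     | lcp≡ , <≡ = cong suc lcp≡ , <≡

lcp-sorted-≤ˡ : ∀ xs ys zs → (xs <lexᵇ ys) ≡ true → (ys <lexᵇ zs) ≡ true → lcp xs zs ≤ lcp xs ys
lcp-sorted-≤ˡ xs ys zs p q with <-≤-connex (lcp xs ys) (lcp xs zs)
... | inj₂ le = le
... | inj₁ lt with lcp-<-transferʳ zs xs ys (subst (lcp xs ys <_) (lcp-comm xs zs) lt)
...   | _ , <≡ with () ← trans (sym (<lexᵇ-asym ys zs q)) (trans <≡ p)

lcp-sorted-≤ʳ : ∀ xs ys zs → (xs <lexᵇ ys) ≡ true → (ys <lexᵇ zs) ≡ true → lcp xs zs ≤ lcp ys zs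
lcp-sorted-≤ʳ xs ys zs p q with <-≤-connex (lcp ys zs) (lcp xs zs)
... | inj₂ le = le
... | inj₁ lt with lcp-<-transferʳ xs zs ys (subst (_< lcp xs zs) (lcp-comm ys zs) lt)
...   | _ , <≡ with () ← trans (sym p) (trans <≡ (<lexᵇ-asym ys zs q))

upd-at : ∀ {A : Set} (f : ℕ → A) i v → upd f i v i ≡ v
upd-at f i v = if-true (≡ᵇ-refl i)

upd-away : ∀ {A : Set} (f : ℕ → A) {i x} v → x ≢ i → upd f i v x ≡ f x
upd-away f v x≢i = if-false (≢⇒≡ᵇ≡false x≢i)

upd-if-at : ∀ {A : Set} (x : Bool) (f : ℕ → A) i v → (if x then upd f i v else f) i ≡ (if x then v else f i)
upd-if-at true  f i v = upd-at f i v
upd-if-at false f i v = refl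

upd-if-away : ∀ {A : Set} (x : Bool) (f : ℕ → A) {i y} v → y ≢ i → (if x then upd f i v else f) y ≡ f y
upd-if-away true  f v y≢i = upd-away f v y≢i
upd-if-away false f v y≢i = refl

drop-++-≤ : ∀ d (xs ys : List ℕ) → d ≤ length xs → drop d (xs ++ ys) ≡ drop d xs ++ ys
drop-++-≤ zero    xs       ys _         = refl
drop-++-≤ (suc d) (x ∷ xs) ys (s≤s d≤) = drop-++-≤ d xs ys d≤

drop-++-length : ∀ (xs ys : List ℕ) d → drop (length xs + d) (xs ++ ys) ≡ drop d ys
drop-++-length []       ys d = refl
drop-++-length (x ∷ xs) ys d = drop-++-length xs ys d

drop-injective : ∀ {d d'} (xs : List ℕ) → d ≤ length xs → d' ≤ length xs → drop d xs ≡ drop d' xs → d ≡ d'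
drop-injective {d} {d'} xs d≤ d'≤ e =
  ∸-cancelˡ-≡ d≤ d'≤ (trans (sym (length-drop d xs)) (trans (cong length e) (length-drop d' xs)))

drop-at : ∀ (xs : List ℕ) d → d < length xs → drop d xs ≡ at xs (suc d) ∷ drop (suc d) xs
drop-at (x ∷ xs) zero    _         = refl
drop-at (x ∷ xs) (suc d) (s≤s d<) = drop-at xs d d<

at-++-< : ∀ (xs ys : List ℕ) d → d < length xs → at (xs ++ ys) (suc d) ≡ at xs (suc d)
at-++-< (x ∷ xs) ys zero    _         = refl
at-++-< (x ∷ xs) ys (suc d) (s≤s d<) = at-++-< xs ys d d<

at-++-length : ∀ (xs ys : List ℕ) d → at (xs ++ ys) (suc (length xs + d)) ≡ at ys (suc d)
at-++-length []       ys d = refl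
at-++-length (x ∷ xs) ys d = at-++-length xs ys d

at-last : ∀ (xs : List ℕ) c → at (xs ++ c ∷ []) (suc (length xs)) ≡ c
at-last xs c = subst (λ z → at (xs ++ c ∷ []) (suc z) ≡ c) (+-identityʳ (length xs)) (at-++-length xs (c ∷ []) 0)

at-All : ∀ {P : ℕ → Set} (xs : List ℕ) d → All P xs → d < length xs → P (at xs (suc d))
at-All (x ∷ xs) zero    (px ∷ _)  _         = px
at-All (x ∷ xs) (suc d) (_ ∷ pxs) (s≤s d<) = at-All xs d pxs d<

All-drop : ∀ {P : ℕ → Set} d (xs : List ℕ) → All P xs → All P (drop d xs)
All-drop zero    xs       pxs       = pxs
All-drop (suc d) []       []        = []
All-drop (suc d) (x ∷ xs) (_ ∷ pxs) = All-drop d xs pxs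

<lexᵇ-after-sentinel : ∀ (us vs xs ys : List ℕ) → All (2 ≤_) us → All (2 ≤_) vs → us ≢ vs →
  (us ++ 0 ∷ xs <lexᵇ vs ++ 0 ∷ ys) ≡ (us ++ 0 ∷ [] <lexᵇ vs ++ 0 ∷ [])
<lexᵇ-after-sentinel []       []       xs ys _ _ us≢vs = ⊥-elim (us≢vs refl)
<lexᵇ-after-sentinel []       (v ∷ vs) xs ys _ (2≤v ∷ _) _ =
  trans (<lexᵇ-∷-≢ xs (vs ++ 0 ∷ ys) 0≢v) (sym (<lexᵇ-∷-≢ [] (vs ++ 0 ∷ []) 0≢v))
  where 0≢v = λ 0≡v → <⇒≢ (<-trans z<s 2≤v) 0≡v
<lexᵇ-after-sentinel (u ∷ us) []       xs ys (2≤u ∷ _) _ _ =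
  trans (<lexᵇ-∷-≢ (us ++ 0 ∷ xs) ys u≢0) (sym (<lexᵇ-∷-≢ (us ++ 0 ∷ []) [] u≢0))
  where u≢0 = λ u≡0 → <⇒≢ (<-trans z<s 2≤u) (sym u≡0)
<lexᵇ-after-sentinel (u ∷ us) (v ∷ vs) xs ys (_ ∷ pus) (_ ∷ pvs) us≢vs with ≡ᵇ-cases u v
... | equal e refl rewrite e =
  <lexᵇ-after-sentinel us vs xs ys pus pvs (λ us≡vs → us≢vs (cong (u ∷_) us≡vs))
... | unequal _ u≢v =
  trans (<lexᵇ-∷-≢ (us ++ 0 ∷ xs) (vs ++ 0 ∷ ys) u≢v) (sym (<lexᵇ-∷-≢ (us ++ 0 ∷ []) (vs ++ 0 ∷ []) u≢v))

module SuffixArray (X : List ℕ) (sa : ℕ → ℕ) (isSA : IsSA X sa) where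

  sa-maps : IsSelfMap (length X) sa
  sa-maps i i∈ = proj₁ isSA i (proj₁ i∈) (proj₂ i∈)

  sa-sorted : ∀ i j → i ∈[1, length X ] → i < j → j ≤ length X →
    (suf X (sa i) <lexᵇ suf X (sa j)) ≡ true
  sa-sorted i j i∈ i<j j≤ = <lex⇒<lexᵇ _ _ (proj₂ isSA i j (proj₁ i∈) i<j j≤)

  sa-<lexᵇ : ∀ i j → i ∈[1, length X ] → j ∈[1, length X ] →
    (suf X (sa i) <lexᵇ suf X (sa j)) ≡ (i <ᵇ j)
  sa-<lexᵇ i j i∈ j∈ with <-cmp i j
  ... | tri< i<j _ _ = trans (sa-sorted i j i∈ i<j (proj₂ j∈)) (sym (<⇒<ᵇ≡true i<j))
  ... | tri≈ _ refl _ = trans (<lexᵇ-irrefl (suf X (sa i))) (sym (≥⇒<ᵇ≡false {i} ≤-refl))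
  ... | tri> _ _ j<i =
    trans (<lexᵇ-asym (suf X (sa j)) _ (sa-sorted j i j∈ j<i (proj₂ i∈))) (sym (≥⇒<ᵇ≡false (<⇒≤ j<i)))

  sa-inj : IsInjectiveOn (length X) sa
  sa-inj i j i∈ j∈ sai≡saj =
    ≤-antisym (<ᵇ≡false⇒≥ j i (not-before j i j∈ i∈ (sym sai≡saj))) (<ᵇ≡false⇒≥ i j (not-before i j i∈ j∈ sai≡saj))
    where
    not-before : ∀ a b → a ∈[1, length X ] → b ∈[1, length X ] → sa a ≡ sa b → (a <ᵇ b) ≡ false
    not-before a b a∈ b∈ e =
      trans (sym (sa-<lexᵇ a b a∈ b∈)) (subst (λ z → (suf X (sa a) <lexᵇ suf X z) ≡ false) e (<lexᵇ-irrefl (suf X (sa a))))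

  rank : ℕ → ℕ
  rank p = suc (count (length X) (λ q → suf X q <lexᵇ suf X p))

  rank-sa : ∀ r → r ∈[1, length X ] → rank (sa r) ≡ r
  rank-sa r r∈ = begin
    suc (count (length X) (λ q → suf X q <lexᵇ suf X (sa r)))
      ≡⟨ cong suc (count-∘-permutation sa-maps sa-inj (λ q → suf X q <lexᵇ suf X (sa r))) ⟨
    suc (count (length X) (λ i → suf X (sa i) <lexᵇ suf X (sa r)))
      ≡⟨ cong suc (count-cong (length X) _ _ (λ i i∈ → sa-<lexᵇ i r i∈ r∈)) ⟩
    suc (count (length X) (_<ᵇ r))
      ≡⟨ cong suc (count-<ᵇ (length X) r (m≤n⇒m≤1+n (proj₂ r∈))) ⟩
    suc (r ∸ 1)
      ≡⟨ m+[n∸m]≡n (proj₁ r∈) ⟩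
    r ∎
    where open ≡-Reasoning

  sa⁻¹-maps : IsSelfMap (length X) (f⁻¹ sa-maps sa-inj)
  sa⁻¹-maps = f⁻¹-maps sa-maps sa-inj

  rank≡sa⁻¹ : ∀ p → p ∈[1, length X ] → rank p ≡ f⁻¹ sa-maps sa-inj p
  rank≡sa⁻¹ p p∈ =
    trans (cong rank (sym (f∘f⁻¹ sa-maps sa-inj p p∈))) (rank-sa _ (sa⁻¹-maps p p∈))

  sa-rank : ∀ p → p ∈[1, length X ] → sa (rank p) ≡ p
  sa-rank p p∈ = trans (cong sa (rank≡sa⁻¹ p p∈)) (f∘f⁻¹ sa-maps sa-inj p p∈)

  rank-maps : IsSelfMap (length X) rank
  rank-maps p p∈ = subst (_∈[1, length X ]) (sym (rank≡sa⁻¹ p p∈)) (sa⁻¹-maps p p∈)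

sameId-true : ∀ m x → sameId m x ≡ true → m ≡ just x
sameId-true (just a) x e = cong just (≡ᵇ≡true⇒≡ a x e)

countLess-∷ : ∀ c y ys → countLess c (y ∷ ys) ≡ bit (y <ᵇ c) + countLess c ys
countLess-∷ c y ys with y <ᵇ c
... | true  = refl
... | false = refl

countLess-applyUpTo : ∀ c (f g : ℕ → ℕ) n →
  countLess c (map f (applyUpTo g n)) ≡ count n (λ i → f (g (i ∸ 1)) <ᵇ c)
countLess-applyUpTo c f g zero    = refl
countLess-applyUpTo c f g (suc n) = begin
  countLess c (f (g 0) ∷ map f (applyUpTo (λ i → g (suc i)) n))
    ≡⟨ countLess-∷ c (f (g 0)) _ ⟩
  bit (f (g 0) <ᵇ c) + countLess c (map f (applyUpTo (λ i → g (suc i)) n))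
    ≡⟨ cong (bit (f (g 0) <ᵇ c) +_) (countLess-applyUpTo c f (λ i → g (suc i)) n) ⟩
  bit (f (g 0) <ᵇ c) + count n (λ i → f (g (suc (i ∸ 1))) <ᵇ c)
    ≡⟨ cong₂ _+_ (+-identityʳ _) (count-cong n _ _ (λ { (suc i) _ → refl })) ⟨
  count 1 (λ i → f (g (i ∸ 1)) <ᵇ c) + count n (λ i → f (g i) <ᵇ c)
    ≡⟨ count-+ 1 n (λ i → f (g (i ∸ 1)) <ᵇ c) ⟨
  count (suc n) (λ i → f (g (i ∸ 1)) <ᵇ c) ∎
  where open ≡-Reasoning

-- The order of phase h

-- The Bool tags the text a string comes from (false: T₀, true: T₁).
tieBreak : Bool → List ℕ → Bool → List ℕ → Bool
tieBreak true  xs b' ys = b' ∧ (xs <lexᵇ ys)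
tieBreak false xs b' ys = b' ∨ (xs <lexᵇ ys)

-- The order of the suffixes in Z^(h).
order : ℕ → List ℕ → Bool → List ℕ → Bool → Bool
order h xs b ys b' = if lcp xs ys <ᵇ h then xs <lexᵇ ys else tieBreak b xs b' ys

order-< : ∀ h xs b ys b' → lcp xs ys < h → order h xs b ys b' ≡ (xs <lexᵇ ys)
order-< h xs b ys b' lt = if-true (<⇒<ᵇ≡true lt)

order-≥ : ∀ h xs b ys b' → h ≤ lcp xs ys → order h xs b ys b' ≡ tieBreak b xs b' ys
order-≥ h xs b ys b' ge = if-false (≥⇒<ᵇ≡false ge)

tieBreak-same : ∀ b xs ys → tieBreak b xs b ys ≡ (xs <lexᵇ ys)
tieBreak-same true  xs ys = refl
tieBreak-same false xs ys = refl

order-same : ∀ h xs b ys → order h xs b ys b ≡ (xs <lexᵇ ys)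
order-same h xs b ys with <-≤-connex (lcp xs ys) h
... | inj₁ lt = order-< h xs b ys b lt
... | inj₂ ge = trans (order-≥ h xs b ys b ge) (tieBreak-same b xs ys)

order-irrefl : ∀ h xs b → order h xs b xs b ≡ false
order-irrefl h xs b = trans (order-same h xs b xs) (<lexᵇ-irrefl xs)

tieBreak-trans : ∀ b xs b' ys b'' zs →
  tieBreak b xs b' ys ≡ true → tieBreak b' ys b'' zs ≡ true → tieBreak b xs b'' zs ≡ true
tieBreak-trans true  xs true  ys true  zs p q = <lexᵇ-trans xs ys zs p q
tieBreak-trans false xs b'    ys true  zs p q = refl
tieBreak-trans false xs false ys false zs p q = <lexᵇ-trans xs ys zs p q
tieBreak-trans true  xs false ys b''   zs () q
tieBreak-trans b     xs true  ys false zs p ()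

tieBreak-total : ∀ b xs b' ys → xs ≢ ys → tieBreak b xs b' ys ≡ true ⊎ tieBreak b' ys b xs ≡ true
tieBreak-total true  xs false ys _     = inj₂ refl
tieBreak-total false xs true  ys _     = inj₁ refl
tieBreak-total true  xs true  ys xs≢ys = <lexᵇ-total xs ys xs≢ys
tieBreak-total false xs false ys xs≢ys = <lexᵇ-total xs ys xs≢ys

order-trans : ∀ h xs b ys b' zs b'' →
  order h xs b ys b' ≡ true → order h ys b' zs b'' ≡ true → order h xs b zs b'' ≡ true
order-trans h xs b ys b' zs b'' p q with <-≤-connex (lcp xs ys) h | <-≤-connex (lcp ys zs) h
... | inj₁ xy<h | inj₁ yz<h =
  let xy = trans (sym (order-< h xs b ys b' xy<h)) p
      yz = trans (sym (order-< h ys b' zs b'' yz<h)) q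
  in trans (order-< h xs b zs b'' (≤-<-trans (lcp-sorted-≤ˡ xs ys zs xy yz) xy<h)) (<lexᵇ-trans xs ys zs xy yz)
... | inj₁ xy<h | inj₂ h≤yz =
  let (lcp≡ , <≡) = lcp-<-transferˡ xs ys zs (<-≤-trans xy<h h≤yz)
  in trans (order-< h xs b zs b'' (subst (_< h) (sym lcp≡) xy<h))
           (trans <≡ (trans (sym (order-< h xs b ys b' xy<h)) p))
... | inj₂ h≤xy | inj₁ yz<h =
  let (lcp≡ , <≡) = lcp-<-transferʳ xs ys zs (<-≤-trans yz<h h≤xy)
  in trans (order-< h xs b zs b'' (subst (_< h) (sym lcp≡) yz<h))
           (trans <≡ (trans (sym (order-< h ys b' zs b'' yz<h)) q))
... | inj₂ h≤xy | inj₂ h≤yz =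
  trans (order-≥ h xs b zs b'' (lcp-≥-trans h xs ys zs h≤xy h≤yz))
        (tieBreak-trans b xs b' ys b'' zs (trans (sym (order-≥ h xs b ys b' h≤xy)) p)
                                          (trans (sym (order-≥ h ys b' zs b'' h≤yz)) q))

order-total : ∀ h xs b ys b' → xs ≢ ys → order h xs b ys b' ≡ true ⊎ order h ys b' xs b ≡ true
order-total h xs b ys b' xs≢ys with <-≤-connex (lcp xs ys) h | <lexᵇ-total xs ys xs≢ys | tieBreak-total b xs b' ys xs≢ys
... | inj₁ lt | inj₁ xy | _ = inj₁ (trans (order-< h xs b ys b' lt) xy)
... | inj₁ lt | inj₂ yx | _ = inj₂ (trans (order-< h ys b' xs b (subst (_< h) (lcp-comm xs ys) lt)) yx)
... | inj₂ ge | _ | inj₁ xy = inj₁ (trans (order-≥ h xs b ys b' ge) xy)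
... | inj₂ ge | _ | inj₂ yx = inj₂ (trans (order-≥ h ys b' xs b (subst (h ≤_) (lcp-comm xs ys) ge)) yx)

order-∷ : ∀ h c xs b ys b' → order (suc h) (c ∷ xs) b (c ∷ ys) b' ≡ order h xs b ys b'
order-∷ h c xs true  ys b' rewrite ≡ᵇ-refl c = refl
order-∷ h c xs false ys b' rewrite ≡ᵇ-refl c = refl

order-∷-≢ : ∀ h {c d} xs b ys b' → c ≢ d → order (suc h) (c ∷ xs) b (d ∷ ys) b' ≡ (c <ᵇ d)
order-∷-≢ h xs b ys b' c≢d rewrite lcp-∷-≢ xs ys c≢d = <lexᵇ-∷-≢ xs ys c≢d

lastMarked : (ℕ → Bool) → ℕ → ℕ
lastMarked P zero    = 0
lastMarked P (suc m) = if P (suc m) then suc m else lastMarked P m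

lastMarked-≤ : ∀ P k → lastMarked P k ≤ k
lastMarked-≤ P zero    = z≤n
lastMarked-≤ P (suc k) with P (suc k)
... | true  = ≤-refl
... | false = m≤n⇒m≤1+n (lastMarked-≤ P k)

lastMarked-≥ : ∀ P m k → 1 ≤ m → m ≤ k → P m ≡ true → m ≤ lastMarked P k
lastMarked-≥ P m zero    1≤m m≤k _ with () ← ≤-trans 1≤m m≤k
lastMarked-≥ P m (suc k) 1≤m m≤k Pm with m≤n⇒m<n∨m≡n m≤k
... | inj₂ refl rewrite Pm = ≤-refl
... | inj₁ m<   with P (suc k)
...   | true  = m≤k
...   | false = lastMarked-≥ P m k 1≤m (≤-pred m<) Pm

lastMarked-const : ∀ P k' k → k' ≤ k → (∀ m → k' < m → m ≤ k → P m ≡ false) →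
  lastMarked P k ≡ lastMarked P k'
lastMarked-const P k' zero    k'≤k _ with refl ← n≤0⇒n≡0 k'≤k = refl
lastMarked-const P k' (suc k) k'≤k unmarked with m≤n⇒m<n∨m≡n k'≤k
... | inj₂ refl = refl
... | inj₁ k'<  rewrite unmarked (suc k) k'< ≤-refl =
  lastMarked-const P k' k (≤-pred k'<) (λ m k'<m m≤k → unmarked m k'<m (m≤n⇒m≤1+n m≤k))

lastMarked-≡⇒unmarked : ∀ P k' k → lastMarked P k' ≡ lastMarked P k →
  ∀ m → k' < m → m ≤ k → P m ≡ false
lastMarked-≡⇒unmarked P k' k same m k'<m m≤k with P m in Pm
... | false = refl
... | true  = ⊥-elim (<-irrefl refl (begin-strict
    k'                 <⟨ k'<m ⟩
    m                  ≤⟨ lastMarked-≥ P m k (≤-trans (s≤s z≤n) k'<m) m≤k Pm ⟩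
    lastMarked P k     ≡⟨ same ⟨
    lastMarked P k'    ≤⟨ lastMarked-≤ P k' ⟩
    k'                 ∎))
  where open ≤-Reasoning

not-≡ᵇ≡<ᵇ : ∀ a b L H → (a ≡ b → H ≤ L) → (H ≤ L → a ≡ b) → not (a ≡ᵇ b) ≡ (L <ᵇ H)
not-≡ᵇ≡<ᵇ a b L H a≡b⇒ ⇒a≡b with ≡ᵇ-cases a b | <-≤-connex L H
... | equal e a≡b   | _      = trans (cong not e) (sym (≥⇒<ᵇ≡false (a≡b⇒ a≡b)))
... | unequal e _   | inj₁ lt = trans (cong not e) (sym (<⇒<ᵇ≡true lt))
... | unequal _ a≢b | inj₂ ge = ⊥-elim (a≢b (⇒a≡b ge))

-- The update of one B entry in phase H+1, with L its LCP value.
B-update : ∀ L H v (mark : Bool) → v ≡ (if L <ᵇ H then suc L else 0) → mark ≡ (L <ᵇ suc H) →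
  (if (v ≡ᵇ 0) ∧ mark then suc H else v) ≡ (if L <ᵇ suc H then suc L else 0)
B-update L H v mark refl mark≡ with <-≤-connex L H
... | inj₁ L<H rewrite <⇒<ᵇ≡true L<H | <⇒<ᵇ≡true (m≤n⇒m≤1+n L<H) = refl
... | inj₂ H≤L with m≤n⇒m<n∨m≡n H≤L
...   | inj₂ refl rewrite mark≡ | ≥⇒<ᵇ≡false {L} ≤-refl | <⇒<ᵇ≡true {L} ≤-refl = refl
...   | inj₁ H<L  rewrite mark≡ | ≥⇒<ᵇ≡false H≤L | ≥⇒<ᵇ≡false H<L = refl

module Gap (w₀ w₁ : List ℕ) (w₀≥2 : All (2 ≤_) w₀) (w₁≥2 : All (2 ≤_) w₁) where

  T₀ T₁ T₀₁ : List ℕ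
  T₀  = w₀ ++ 0 ∷ []
  T₁  = w₁ ++ 1 ∷ []
  T₀₁ = T₀ ++ T₁

  n₀ n₁ N : ℕ
  n₀ = length T₀
  n₁ = length T₁
  N  = n₀ + n₁

  n₀≡ : n₀ ≡ suc (length w₀)
  n₀≡ = trans (length-++ w₀) (+-comm (length w₀) 1)

  n₁≡ : n₁ ≡ suc (length w₁)
  n₁≡ = trans (length-++ w₁) (+-comm (length w₁) 1)

  length-T₀₁ : length T₀₁ ≡ N
  length-T₀₁ = length-++ T₀

  1≤n₀ : 1 ≤ n₀
  1≤n₀ rewrite n₀≡ = s≤s z≤n

  1≤n₁ : 1 ≤ n₁
  1≤n₁ rewrite n₁≡ = s≤s z≤n

  n₀<N : n₀ < N
  n₀<N = subst (_≤ N) (+-comm n₀ 1) (+-monoʳ-≤ n₀ 1≤n₁)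

  n₀∈ : n₀ ∈[1, N ]
  n₀∈ = 1≤n₀ , <⇒≤ n₀<N

  N∈ : N ∈[1, N ]
  N∈ = ≤-trans 1≤n₀ (<⇒≤ n₀<N) , ≤-refl

  n₀+∈ : ∀ {i} → i ∈[1, n₁ ] → n₀ + i ∈[1, N ]
  n₀+∈ {i} (1≤i , i≤n₁) = ≤-trans 1≤i (m≤n+m i n₀) , +-monoʳ-≤ n₀ i≤n₁

  char : ℕ → ℕ
  char = at T₀₁

  Suf : ℕ → List ℕ
  Suf = suf T₀₁

  char-T₀ : ∀ p → p ∈[1, n₀ ] → char p ≡ at T₀ p
  char-T₀ (suc d) (_ , p≤) = at-++-< T₀ T₁ d p≤

  char-T₁ : ∀ i → 1 ≤ i → char (n₀ + i) ≡ at T₁ i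
  char-T₁ (suc d) _ = trans (cong char (+-suc n₀ d)) (at-++-length T₀ T₁ d)

  char-n₀ : char n₀ ≡ 0
  char-n₀ = trans (char-T₀ n₀ (1≤n₀ , ≤-refl)) (trans (cong (at T₀) n₀≡) (at-last w₀ 0))

  char-N : char N ≡ 1
  char-N = trans (char-T₁ n₁ 1≤n₁) (trans (cong (at T₁) n₁≡) (at-last w₁ 1))

  char-w₀ : ∀ d → suc d < n₀ → 2 ≤ char (suc d)
  char-w₀ d 1+d<n₀ = subst (2 ≤_) (sym (trans (char-T₀ (suc d) (s≤s z≤n , <⇒≤ 1+d<n₀)) (at-++-< w₀ _ d d<)))
                           (at-All w₀ d w₀≥2 d<)
    where d< = ≤-pred (subst (suc d <_) n₀≡ 1+d<n₀)

  char-w₁ : ∀ i → 1 ≤ i → i < n₁ → 2 ≤ char (n₀ + i)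
  char-w₁ (suc d) _ 1+d<n₁ = subst (2 ≤_) (sym (trans (char-T₁ (suc d) (s≤s z≤n)) (at-++-< w₁ _ d d<)))
                                   (at-All w₁ d w₁≥2 d<)
    where d< = ≤-pred (subst (suc d <_) n₁≡ 1+d<n₁)

  char≥2 : ∀ p → p ∈[1, N ] → p ≢ n₀ → p ≢ N → 2 ≤ char p
  char≥2 (suc d) (_ , p≤N) p≢n₀ p≢N with <-cmp (suc d) n₀
  ... | tri< p<n₀ _ _ = char-w₀ d p<n₀
  ... | tri≈ _ p≡n₀ _ = ⊥-elim (p≢n₀ p≡n₀)
  ... | tri> _ _ n₀<p = subst (λ z → 2 ≤ char z) p≡ (char-w₁ (suc d ∸ n₀) (m<n⇒0<n∸m n₀<p) i<n₁)
    where
    p≡ = m+[n∸m]≡n (<⇒≤ n₀<p)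
    i<n₁ = ≤∧≢⇒< (+-cancelˡ-≤ n₀ _ n₁ (subst (_≤ N) (sym p≡) p≤N)) (λ e → p≢N (trans (sym p≡) (cong (n₀ +_) e)))

  char≡0 : ∀ p → p ∈[1, N ] → char p ≡ 0 → p ≡ n₀
  char≡0 p p∈ e with ≡ᵇ-cases p n₀ | ≡ᵇ-cases p N
  ... | equal _ p≡n₀ | _            = p≡n₀
  ... | unequal _ _  | equal _ refl with () ← trans (sym char-N) e
  ... | unequal _ p≢n₀ | unequal _ p≢N with () ← subst (2 ≤_) e (char≥2 p p∈ p≢n₀ p≢N)

  char≡1 : ∀ p → p ∈[1, N ] → char p ≡ 1 → p ≡ N
  char≡1 p p∈ e with ≡ᵇ-cases p N | ≡ᵇ-cases p n₀
  ... | equal _ p≡N  | _            = p≡N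
  ... | unequal _ _  | equal _ refl with () ← trans (sym char-n₀) e
  ... | unequal _ p≢N | unequal _ p≢n₀ with s≤s () ← subst (2 ≤_) e (char≥2 p p∈ p≢n₀ p≢N)

  char<2-unique : ∀ p q → p ∈[1, N ] → q ∈[1, N ] → char p ≡ char q → char q < 2 → p ≡ q
  char<2-unique p q p∈ q∈ e q<2 with char q in eq
  ... | zero          = trans (char≡0 p p∈ e) (sym (char≡0 q q∈ eq))
  ... | suc zero      = trans (char≡1 p p∈ e) (sym (char≡1 q q∈ eq))
  ... | suc (suc _)   with s≤s (s≤s ()) ← q<2

  Suf-∷ : ∀ p → p ∈[1, N ] → Suf p ≡ char p ∷ Suf (suc p)
  Suf-∷ (suc d) (_ , p≤N) = drop-at T₀₁ d (subst (suc d ≤_) (sym length-T₀₁) p≤N)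

  Suf-inj : ∀ p q → p ∈[1, N ] → q ∈[1, N ] → Suf p ≡ Suf q → p ≡ q
  Suf-inj (suc d) (suc d') (_ , p≤N) (_ , q≤N) e =
    cong suc (drop-injective T₀₁ (≤-trans (n≤1+n d) (subst (suc d ≤_) (sym length-T₀₁) p≤N))
                                 (≤-trans (n≤1+n d') (subst (suc d' ≤_) (sym length-T₀₁) q≤N)) e)

  suf-T₁ : ∀ i → 1 ≤ i → suf T₁ i ≡ Suf (n₀ + i)
  suf-T₁ (suc d) _ = sym (trans (cong (λ z → drop (z ∸ 1) T₀₁) (+-suc n₀ d)) (drop-++-length T₀ T₁ d))

  pred≤length-w₀ : ∀ {p} → p ∈[1, n₀ ] → p ∸ 1 ≤ length w₀
  pred≤length-w₀ {suc d} (_ , p≤) = ≤-pred (subst (suc d ≤_) n₀≡ p≤)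

  suf-T₀-drop : ∀ p → p ∈[1, n₀ ] → suf T₀ p ≡ drop (p ∸ 1) w₀ ++ 0 ∷ []
  suf-T₀-drop p p∈ = drop-++-≤ (p ∸ 1) w₀ (0 ∷ []) (pred≤length-w₀ p∈)

  Suf-T₀-drop : ∀ p → p ∈[1, n₀ ] → Suf p ≡ drop (p ∸ 1) w₀ ++ 0 ∷ T₁
  Suf-T₀-drop p p∈ =
    trans (drop-++-≤ (p ∸ 1) T₀ T₁ (≤-trans (pred≤length-w₀ p∈) (≤-trans (n≤1+n _) (≤-reflexive (sym n₀≡)))))
          (trans (cong (_++ T₁) (suf-T₀-drop p p∈)) (++-assoc (drop (p ∸ 1) w₀) (0 ∷ []) T₁))

  -- Suffixes of T₀ are ordered in T₀₁ as in T₀: the unique sentinel 0 decides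
  -- every comparison before T₁ is reached.
  suf-T₀-<lexᵇ : ∀ p q → p ∈[1, n₀ ] → q ∈[1, n₀ ] → (suf T₀ p <lexᵇ suf T₀ q) ≡ (Suf p <lexᵇ Suf q)
  suf-T₀-<lexᵇ p q p∈ q∈ with ≡ᵇ-cases p q
  ... | equal _ refl = trans (<lexᵇ-irrefl (suf T₀ p)) (sym (<lexᵇ-irrefl (Suf p)))
  ... | unequal _ p≢q rewrite suf-T₀-drop p p∈ | suf-T₀-drop q q∈ | Suf-T₀-drop p p∈ | Suf-T₀-drop q q∈ =
    sym (<lexᵇ-after-sentinel (drop (p ∸ 1) w₀) (drop (q ∸ 1) w₀) T₁ T₁
          (All-drop (p ∸ 1) w₀ w₀≥2) (All-drop (q ∸ 1) w₀ w₀≥2) drops≢)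
    where
    drops≢ : drop (p ∸ 1) w₀ ≢ drop (q ∸ 1) w₀
    drops≢ e = p≢q (begin
      p           ≡⟨ m+[n∸m]≡n (proj₁ p∈) ⟨
      suc (p ∸ 1) ≡⟨ cong suc (drop-injective w₀ (pred≤length-w₀ p∈) (pred≤length-w₀ q∈) e) ⟩
      suc (q ∸ 1) ≡⟨ m+[n∸m]≡n (proj₁ q∈) ⟩
      q           ∎)
      where open ≡-Reasoning

  -- prev p is the position of the symbol preceding suffix p, cyclically
  -- within its own text; next is its inverse.
  prev : ℕ → ℕ
  prev p = if p ≡ᵇ 1 then n₀ else (if p ≡ᵇ suc n₀ then N else p ∸ 1)

  next : ℕ → ℕ
  next q = if q ≡ᵇ n₀ then 1 else (if q ≡ᵇ N then suc n₀ else suc q)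

  data PrevCase (p : ℕ) : Set where
    start₀ : p ≡ 1      → prev p ≡ n₀ → PrevCase p
    start₁ : p ≡ suc n₀ → prev p ≡ N  → PrevCase p
    inner  : ∀ d → p ≡ suc (suc d) → p ≢ suc n₀ → prev p ≡ suc d → PrevCase p

  prevCase : ∀ p → p ∈[1, N ] → PrevCase p
  prevCase (suc zero)    _ = start₀ refl refl
  prevCase (suc (suc d)) _ with ≡ᵇ-cases (suc (suc d)) (suc n₀)
  ... | equal e p≡     = start₁ p≡ (if-true e)
  ... | unequal e p≢   = inner d refl p≢ (if-false e)

  N≢n₀ : N ≢ n₀
  N≢n₀ N≡n₀ = <⇒≢ n₀<N (sym N≡n₀)

  next∘prev : ∀ p → p ∈[1, N ] → next (prev p) ≡ p
  next∘prev p p∈ with prevCase p p∈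
  ... | start₀ refl e rewrite e | ≡ᵇ-refl n₀ = refl
  ... | start₁ refl e rewrite e | ≢⇒≡ᵇ≡false N≢n₀ | ≡ᵇ-refl N = refl
  ... | inner d refl p≢ e
    rewrite e | ≢⇒≡ᵇ≡false {suc d} {n₀} (λ d≡ → p≢ (cong suc d≡)) | ≢⇒≡ᵇ≡false {suc d} {N} (<⇒≢ (proj₂ p∈)) = refl

  prev-maps : IsSelfMap N prev
  prev-maps p p∈ with prevCase p p∈
  ... | start₀ _ e = subst (_∈[1, N ]) (sym e) n₀∈
  ... | start₁ _ e = subst (_∈[1, N ]) (sym e) N∈
  ... | inner d refl _ e = subst (_∈[1, N ]) (sym e) (s≤s z≤n , ≤-trans (n≤1+n _) (proj₂ p∈))

  prev-inj : IsInjectiveOn N prev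
  prev-inj p q p∈ q∈ e = trans (sym (next∘prev p p∈)) (trans (cong next e) (next∘prev q q∈))

  next≡prev⁻¹ : ∀ q → q ∈[1, N ] → next q ≡ f⁻¹ prev-maps prev-inj q
  next≡prev⁻¹ q q∈ = trans (cong next (sym (f∘f⁻¹ prev-maps prev-inj q q∈)))
                           (next∘prev _ (f⁻¹-maps prev-maps prev-inj q q∈))

  prev∘next : ∀ q → q ∈[1, N ] → prev (next q) ≡ q
  prev∘next q q∈ = trans (cong prev (next≡prev⁻¹ q q∈)) (f∘f⁻¹ prev-maps prev-inj q q∈)

  next-maps : IsSelfMap N next
  next-maps q q∈ = subst (_∈[1, N ]) (sym (next≡prev⁻¹ q q∈)) (f⁻¹-maps prev-maps prev-inj q q∈)

  Suf-prev : ∀ p → p ∈[1, N ] → 2 ≤ char (prev p) → Suf (prev p) ≡ char (prev p) ∷ Suf p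
  Suf-prev p p∈ c≥2 with prevCase p p∈
  ... | start₀ _ e rewrite e | char-n₀ with () ← c≥2
  ... | start₁ _ e rewrite e | char-N with s≤s () ← c≥2
  ... | inner d refl _ e rewrite e = Suf-∷ (suc d) (s≤s z≤n , ≤-trans (n≤1+n _) (proj₂ p∈))

  Suf-next : ∀ q → q ∈[1, N ] → 2 ≤ char q → Suf q ≡ char q ∷ Suf (next q)
  Suf-next q q∈ c≥2 = begin
    Suf q                                ≡⟨ cong Suf (prev∘next q q∈) ⟨
    Suf (prev (next q))                  ≡⟨ Suf-prev (next q) (next-maps q q∈) (subst (2 ≤_) (cong char (sym (prev∘next q q∈))) c≥2) ⟩
    char (prev (next q)) ∷ Suf (next q)  ≡⟨ cong (λ r → char r ∷ Suf (next q)) (prev∘next q q∈) ⟩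
    char q ∷ Suf (next q)                ∎
    where open ≡-Reasoning

  inT₁ : ℕ → Bool
  inT₁ p = n₀ <ᵇ p

  inT₁-≤ : ∀ {q} → q ≤ n₀ → inT₁ q ≡ false
  inT₁-≤ = ≥⇒<ᵇ≡false

  inT₁-> : ∀ {q} → n₀ < q → inT₁ q ≡ true
  inT₁-> = <⇒<ᵇ≡true

  inT₁-n₀+ : ∀ {i} → 1 ≤ i → inT₁ (n₀ + i) ≡ true
  inT₁-n₀+ {i} 1≤i = inT₁-> (≤-trans (≤-reflexive (+-comm 1 n₀)) (+-monoʳ-≤ n₀ 1≤i))

  inT₁-prev : ∀ p → p ∈[1, N ] → inT₁ (prev p) ≡ inT₁ p
  inT₁-prev p p∈ with prevCase p p∈
  ... | start₀ refl e rewrite e = trans (≥⇒<ᵇ≡false {n₀} ≤-refl) (sym (≥⇒<ᵇ≡false 1≤n₀))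
  ... | start₁ refl e rewrite e = trans (<⇒<ᵇ≡true n₀<N) (sym (<⇒<ᵇ≡true {n₀} ≤-refl))
  ... | inner d refl p≢ e rewrite e with <-cmp (suc d) n₀
  ... | tri< d<n₀ _ _ = trans (≥⇒<ᵇ≡false (<⇒≤ d<n₀)) (sym (≥⇒<ᵇ≡false d<n₀))
  ... | tri≈ _ d≡n₀ _ = ⊥-elim (p≢ (cong suc d≡n₀))
  ... | tri> _ _ n₀<d = trans (<⇒<ᵇ≡true n₀<d) (sym (<⇒<ᵇ≡true (≤-trans n₀<d (n≤1+n _))))

  BWT-sa≡1 : ∀ X sa i → sa i ≡ 1 → BWT X sa i ≡ at X (length X)
  BWT-sa≡1 X sa i e with sa i
  BWT-sa≡1 X sa i refl | .1 = refl

  BWT-sa≡2+ : ∀ X sa i d → sa i ≡ suc (suc d) → BWT X sa i ≡ at X (suc d)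
  BWT-sa≡2+ X sa i d e with sa i
  BWT-sa≡2+ X sa i d refl | .(suc (suc d)) = refl

  BWT-T₀ : ∀ sa i → sa i ∈[1, n₀ ] → BWT T₀ sa i ≡ char (prev (sa i))
  BWT-T₀ sa i = by-value (sa i) refl
    where
    by-value : ∀ v → sa i ≡ v → v ∈[1, n₀ ] → BWT T₀ sa i ≡ char (prev v)
    by-value (suc zero) e _ =
      trans (BWT-sa≡1 T₀ sa i e) (trans (cong (at T₀) n₀≡) (trans (at-last w₀ 0) (sym char-n₀)))
    by-value (suc (suc d)) e (_ , v≤n₀)
      rewrite ≢⇒≡ᵇ≡false {suc (suc d)} {suc n₀} (λ e' → <⇒≢ v≤n₀ (suc-injective e')) =
      trans (BWT-sa≡2+ T₀ sa i d e) (sym (char-T₀ (suc d) (s≤s z≤n , ≤-trans (n≤1+n _) v≤n₀)))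

  BWT-T₁ : ∀ sa i → sa i ∈[1, n₁ ] → BWT T₁ sa i ≡ char (prev (n₀ + sa i))
  BWT-T₁ sa i = by-value (sa i) refl
    where
    by-value : ∀ v → sa i ≡ v → v ∈[1, n₁ ] → BWT T₁ sa i ≡ char (prev (n₀ + v))
    by-value (suc zero) e v∈ with prevCase (n₀ + 1) (n₀+∈ v∈)
    ... | start₀ n₀+1≡1 _ = ⊥-elim (<⇒≢ (s≤s 1≤n₀) (sym (trans (+-comm 1 n₀) n₀+1≡1)))
    ... | inner _ _ n₀+1≢ _ = ⊥-elim (n₀+1≢ (+-comm n₀ 1))
    ... | start₁ _ prev≡N rewrite prev≡N =
      trans (BWT-sa≡1 T₁ sa i e) (trans (cong (at T₁) n₁≡) (trans (at-last w₁ 1) (sym char-N)))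
    by-value (suc (suc d)) e v∈ with prevCase (n₀ + suc (suc d)) (n₀+∈ v∈)
    ... | start₀ p≡1 _ = ⊥-elim (m+1+n≢0 n₀ (suc-injective (trans (sym (+-suc n₀ (suc d))) p≡1)))
    ... | start₁ p≡ _ with () ← +-cancelˡ-≡ n₀ (suc (suc d)) 1 (trans p≡ (sym (+-comm n₀ 1)))
    ... | inner _ p≡ _ prev≡ rewrite prev≡ =
      trans (BWT-sa≡2+ T₁ sa i d e)
            (trans (sym (char-T₁ (suc d) (s≤s z≤n))) (cong char (suc-injective (trans (sym (+-suc n₀ (suc d))) p≡))))

  infix 4 _≺[_]_

  _≺[_]_ : ℕ → ℕ → ℕ → Bool
  q ≺[ h ] p = order h (Suf q) (inT₁ q) (Suf p) (inT₁ p)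

  ≺-< : ∀ h q p → lcp (Suf q) (Suf p) < h → (q ≺[ h ] p) ≡ (Suf q <lexᵇ Suf p)
  ≺-< h q p = order-< h (Suf q) (inT₁ q) (Suf p) (inT₁ p)

  ≺-irrefl : ∀ h p → (p ≺[ h ] p) ≡ false
  ≺-irrefl h p = order-irrefl h (Suf p) (inT₁ p)

  ≺-trans : ∀ h q p r → (q ≺[ h ] p) ≡ true → (p ≺[ h ] r) ≡ true → (q ≺[ h ] r) ≡ true
  ≺-trans h q p r = order-trans h (Suf q) (inT₁ q) (Suf p) (inT₁ p) (Suf r) (inT₁ r)

  ≺-total : ∀ h q p → q ∈[1, N ] → p ∈[1, N ] → q ≢ p → (q ≺[ h ] p) ≡ true ⊎ (p ≺[ h ] q) ≡ true
  ≺-total h q p q∈ p∈ q≢p = order-total h (Suf q) (inT₁ q) (Suf p) (inT₁ p) (λ e → q≢p (Suf-inj q p q∈ p∈ e))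

  -- pos h p is the index of suffix p in Z^(h).
  pos : ℕ → ℕ → ℕ
  pos h p = suc (count N (λ q → q ≺[ h ] p))

  pos-maps : ∀ h → IsSelfMap N (pos h)
  pos-maps h p p∈ = s≤s z≤n , count-< N (λ q → q ≺[ h ] p) p p∈ (≺-irrefl h p)

  pos-mono : ∀ h q p → q ∈[1, N ] → (q ≺[ h ] p) ≡ true → pos h q < pos h p
  pos-mono h q p q∈ q≺p =
    s≤s (count-mono-< N _ _ (λ r _ r≺q → ≺-trans h r q p r≺q q≺p) q q∈ (≺-irrefl h q) q≺p)

  pos-inj : ∀ h → IsInjectiveOn N (pos h)
  pos-inj h q p q∈ p∈ e with ≡ᵇ-cases q p
  ... | equal _ q≡p = q≡p
  ... | unequal _ q≢p with ≺-total h q p q∈ p∈ q≢p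
  ...   | inj₁ q≺p = ⊥-elim (<⇒≢ (pos-mono h q p q∈ q≺p) e)
  ...   | inj₂ p≺q = ⊥-elim (<⇒≢ (pos-mono h p q p∈ p≺q) (sym e))

  pos-<ᵇ : ∀ h q p → q ∈[1, N ] → p ∈[1, N ] → (pos h q <ᵇ pos h p) ≡ (q ≺[ h ] p)
  pos-<ᵇ h q p q∈ p∈ with q ≺[ h ] p in q≺p
  ... | true  = <⇒<ᵇ≡true (pos-mono h q p q∈ q≺p)
  ... | false with ≡ᵇ-cases q p
  ...   | equal _ refl = ≥⇒<ᵇ≡false {pos h q} ≤-refl
  ...   | unequal _ q≢p with ≺-total h q p q∈ p∈ q≢p
  ...     | inj₁ q≺p' with () ← trans (sym q≺p) q≺p'
  ...     | inj₂ p≺q = ≥⇒<ᵇ≡false (<⇒≤ (pos-mono h p q p∈ p≺q))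

  pos-<⇒≺ : ∀ h q p → q ∈[1, N ] → p ∈[1, N ] → pos h q < pos h p → (q ≺[ h ] p) ≡ true
  pos-<⇒≺ h q p q∈ p∈ lt = trans (sym (pos-<ᵇ h q p q∈ p∈)) (<⇒<ᵇ≡true lt)

  pos⁻¹ : ℕ → ℕ → ℕ
  pos⁻¹ h = f⁻¹ (pos-maps h) (pos-inj h)

  pos⁻¹-maps : ∀ h → IsSelfMap N (pos⁻¹ h)
  pos⁻¹-maps h = f⁻¹-maps (pos-maps h) (pos-inj h)

  pos∘pos⁻¹ : ∀ h j → j ∈[1, N ] → pos h (pos⁻¹ h j) ≡ j
  pos∘pos⁻¹ h = f∘f⁻¹ (pos-maps h) (pos-inj h)

  pos⁻¹∘pos : ∀ h p → p ∈[1, N ] → pos⁻¹ h (pos h p) ≡ p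
  pos⁻¹∘pos h = f⁻¹∘f (pos-maps h) (pos-inj h)

  count-before-pos : ∀ h (Q : ℕ → Bool) p → p ∈[1, N ] →
    count N (λ m → (m <ᵇ pos h p) ∧ Q (pos⁻¹ h m)) ≡ count N (λ q → (q ≺[ h ] p) ∧ Q q)
  count-before-pos h Q p p∈ =
    trans (sym (count-∘-permutation (pos-maps h) (pos-inj h) (λ m → (m <ᵇ pos h p) ∧ Q (pos⁻¹ h m))))
          (count-cong N _ _ (λ q q∈ → cong₂ _∧_ (pos-<ᵇ h q p q∈ p∈) (cong Q (pos⁻¹∘pos h q q∈))))

  -- The array F at the start of every phase (see F₀≡C).
  C : ℕ → ℕ
  C c = suc (count N (λ q → char q <ᵇ c))

  before : ℕ → ℕ
  before p = char (prev p)

  ≺-head : ∀ h r q → r ∈[1, N ] → q ∈[1, N ] → char r ≢ char q → (r ≺[ suc h ] q) ≡ (char r <ᵇ char q)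
  ≺-head h r q r∈ q∈ c≢d rewrite Suf-∷ r r∈ | Suf-∷ q q∈ =
    order-∷-≢ h (Suf (suc r)) (inT₁ r) (Suf (suc q)) (inT₁ q) c≢d

  ≺-LF : ∀ h p r → p ∈[1, N ] → r ∈[1, N ] → char r ≡ before p → (r ≺[ suc h ] prev p) ≡ (next r ≺[ h ] p)
  ≺-LF h p r p∈ r∈ e with <-≤-connex (before p) 2
  ... | inj₂ c≥2 = begin
      order (suc h) (Suf r) (inT₁ r) (Suf (prev p)) (inT₁ (prev p))
        ≡⟨ cong₂ (λ xs ys → order (suc h) xs (inT₁ r) ys (inT₁ (prev p))) Suf-r (Suf-prev p p∈ c≥2) ⟩
      order (suc h) (before p ∷ Suf s) (inT₁ r) (before p ∷ Suf p) (inT₁ (prev p))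
        ≡⟨ order-∷ h (before p) (Suf s) (inT₁ r) (Suf p) (inT₁ (prev p)) ⟩
      order h (Suf s) (inT₁ r) (Suf p) (inT₁ (prev p))
        ≡⟨ cong₂ (λ b b' → order h (Suf s) b (Suf p) b') inT₁-r (inT₁-prev p p∈) ⟩
      order h (Suf s) (inT₁ s) (Suf p) (inT₁ p) ∎
    where
    open ≡-Reasoning
    s = next r
    s∈ = next-maps r r∈
    Suf-r : Suf r ≡ before p ∷ Suf s
    Suf-r = trans (Suf-next r r∈ (subst (2 ≤_) (sym e) c≥2)) (cong (_∷ Suf s) e)
    inT₁-r : inT₁ r ≡ inT₁ s
    inT₁-r = trans (cong inT₁ (sym (prev∘next r r∈))) (inT₁-prev s s∈)
  ... | inj₁ c<2 = begin
      r ≺[ suc h ] prev p  ≡⟨ cong (r ≺[ suc h ]_) (sym r≡) ⟩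
      r ≺[ suc h ] r       ≡⟨ ≺-irrefl (suc h) r ⟩
      false                ≡⟨ ≺-irrefl h p ⟨
      p ≺[ h ] p           ≡⟨ cong (_≺[ h ] p) (trans (cong next r≡) (next∘prev p p∈)) ⟨
      next r ≺[ h ] p      ∎
    where
    open ≡-Reasoning
    r≡ : r ≡ prev p
    r≡ = char<2-unique r (prev p) r∈ (prev-maps p p∈) e c<2

  pos-LF : ∀ h p → p ∈[1, N ] →
    pos (suc h) (prev p) ≡ C (before p) + count N (λ q → (q ≺[ h ] p) ∧ (before q ≡ᵇ before p))
  pos-LF h p p∈ = begin
      suc (count N P)
        ≡⟨ cong suc (count-split N P (λ r → char r ≡ᵇ c)) ⟩
      suc (count N (λ r → P r ∧ (char r ≡ᵇ c)) + count N (λ r → P r ∧ not (char r ≡ᵇ c)))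
        ≡⟨ cong suc (+-comm (count N (λ r → P r ∧ (char r ≡ᵇ c))) _) ⟩
      suc (count N (λ r → P r ∧ not (char r ≡ᵇ c)) + count N (λ r → P r ∧ (char r ≡ᵇ c)))
        ≡⟨ cong₂ (λ a b → suc (a + b)) (count-cong N _ _ other-symbol) (count-cong N _ _ same-symbol) ⟩
      C c + count N (λ r → (char r ≡ᵇ c) ∧ (next r ≺[ h ] p))
        ≡⟨ cong (C c +_) (count-∘-permutation prev-maps prev-inj (λ r → (char r ≡ᵇ c) ∧ (next r ≺[ h ] p))) ⟨
      C c + count N (λ q → (before q ≡ᵇ c) ∧ (next (prev q) ≺[ h ] p))
        ≡⟨ cong (C c +_) (count-cong N _ _ λ q q∈ →
             trans (cong (λ z → (before q ≡ᵇ c) ∧ (z ≺[ h ] p)) (next∘prev q q∈)) (∧-comm (before q ≡ᵇ c) _)) ⟩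
      C c + count N (λ q → (q ≺[ h ] p) ∧ (before q ≡ᵇ c)) ∎
    where
    open ≡-Reasoning
    c = before p
    P = λ r → r ≺[ suc h ] prev p
    other-symbol : ∀ r → r ∈[1, N ] → (P r ∧ not (char r ≡ᵇ c)) ≡ (char r <ᵇ c)
    other-symbol r r∈ with ≡ᵇ-cases (char r) c
    ... | equal e r≡c rewrite e = trans (∧-zeroʳ (P r)) (sym (≥⇒<ᵇ≡false (≤-reflexive (sym r≡c))))
    ... | unequal e r≢c rewrite e = trans (∧-identityʳ (P r)) (≺-head h r (prev p) r∈ (prev-maps p p∈) r≢c)
    same-symbol : ∀ r → r ∈[1, N ] → (P r ∧ (char r ≡ᵇ c)) ≡ ((char r ≡ᵇ c) ∧ (next r ≺[ h ] p))
    same-symbol r r∈ with ≡ᵇ-cases (char r) c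
    ... | equal e r≡c rewrite e = trans (∧-identityʳ (P r)) (≺-LF h p r p∈ r∈ r≡c)
    ... | unequal e _ rewrite e = ∧-zeroʳ (P r)

  C-mono : ∀ a b → a ≤ b → C a ≤ C b
  C-mono a b a≤b = s≤s (count-mono N _ _ (λ r _ r<a → <⇒<ᵇ≡true (<-≤-trans (<ᵇ≡true⇒< (char r) a r<a) a≤b)))

  C≤pos : ∀ h q → q ∈[1, N ] → C (char q) ≤ pos (suc h) q
  C≤pos h q q∈ = s≤s (count-mono N _ _ smaller-symbol-precedes)
    where
    smaller-symbol-precedes : ∀ r → r ∈[1, N ] → (char r <ᵇ char q) ≡ true → (r ≺[ suc h ] q) ≡ true
    smaller-symbol-precedes r r∈ r<q =
      trans (≺-head h r q r∈ q∈ (<⇒≢ (<ᵇ≡true⇒< (char r) (char q) r<q))) r<q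

  pos<C : ∀ h q → q ∈[1, N ] → pos (suc h) q < C (suc (char q))
  pos<C h q q∈ =
    s≤s (count-mono-< N _ _ predecessor-symbol-≤ q q∈ (≺-irrefl (suc h) q) (<⇒<ᵇ≡true {char q} ≤-refl))
    where
    predecessor-symbol-≤ : ∀ r → r ∈[1, N ] → (r ≺[ suc h ] q) ≡ true → (char r <ᵇ suc (char q)) ≡ true
    predecessor-symbol-≤ r r∈ r≺q with ≡ᵇ-cases (char r) (char q)
    ... | equal _ r≡q = <⇒<ᵇ≡true (s≤s (≤-reflexive r≡q))
    ... | unequal _ r≢q =
      <⇒<ᵇ≡true (s≤s (<⇒≤ (<ᵇ≡true⇒< (char r) (char q) (trans (sym (≺-head h r q r∈ q∈ r≢q)) r≺q))))

  module WithSuffixArrays (sa₀ sa₁ sa₀₁ : ℕ → ℕ) (isSA₀ : IsSA (w₀ ++ 0 ∷ []) sa₀)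
    (isSA₁ : IsSA (w₁ ++ 1 ∷ []) sa₁) (isSA₀₁ : IsSA ((w₀ ++ 0 ∷ []) ++ (w₁ ++ 1 ∷ [])) sa₀₁) where

    module SA₀  = SuffixArray T₀ sa₀ isSA₀
    module SA₁  = SuffixArray T₁ sa₁ isSA₁
    module SA₀₁ = SuffixArray T₀₁ sa₀₁ isSA₀₁

    rank₀ : ∀ h p → p ∈[1, N ] → inT₁ p ≡ false → SA₀.rank p ≡ suc (count N (λ q → not (inT₁ q) ∧ (q ≺[ h ] p)))
    rank₀ h p p∈ p∉T₁ = cong suc (sym (begin
        count N (λ q → not (inT₁ q) ∧ (q ≺[ h ] p))
          ≡⟨ count-+ n₀ n₁ _ ⟩
        count n₀ (λ q → not (inT₁ q) ∧ (q ≺[ h ] p)) + count n₁ (λ i → not (inT₁ (n₀ + i)) ∧ (n₀ + i ≺[ h ] p))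
          ≡⟨ cong₂ _+_ (count-cong n₀ _ _ same-order)
                       (count-none n₁ _ (λ i i∈ → cong (λ b → not b ∧ (n₀ + i ≺[ h ] p)) (inT₁-n₀+ (proj₁ i∈)))) ⟩
        count n₀ (λ q → suf T₀ q <lexᵇ suf T₀ p) + 0
          ≡⟨ +-identityʳ _ ⟩
        count n₀ (λ q → suf T₀ q <lexᵇ suf T₀ p) ∎))
      where
      open ≡-Reasoning
      p∈₀ : p ∈[1, n₀ ]
      p∈₀ = proj₁ p∈ , <ᵇ≡false⇒≥ n₀ p p∉T₁
      same-order : ∀ q → q ∈[1, n₀ ] → (not (inT₁ q) ∧ (q ≺[ h ] p)) ≡ (suf T₀ q <lexᵇ suf T₀ p)
      same-order q q∈ rewrite inT₁-≤ (proj₂ q∈) =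
        trans (trans (cong (λ b → order h (Suf q) false (Suf p) b) p∉T₁) (order-same h (Suf q) false (Suf p)))
              (sym (suf-T₀-<lexᵇ q p q∈ p∈₀))

    rank₁ : ∀ h p → p ∈[1, N ] → inT₁ p ≡ true → SA₁.rank (p ∸ n₀) ≡ suc (count N (λ q → inT₁ q ∧ (q ≺[ h ] p)))
    rank₁ h p p∈ p∈T₁ = cong suc (sym (begin
        count N (λ q → inT₁ q ∧ (q ≺[ h ] p))
          ≡⟨ count-+ n₀ n₁ _ ⟩
        count n₀ (λ q → inT₁ q ∧ (q ≺[ h ] p)) + count n₁ (λ i → inT₁ (n₀ + i) ∧ (n₀ + i ≺[ h ] p))
          ≡⟨ cong₂ _+_ (count-none n₀ _ (λ q q∈ → cong (_∧ (q ≺[ h ] p)) (inT₁-≤ (proj₂ q∈))))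
                       (count-cong n₁ _ _ same-order) ⟩
        count n₁ (λ i → suf T₁ i <lexᵇ suf T₁ (p ∸ n₀)) ∎))
      where
      open ≡-Reasoning
      p≡ : n₀ + (p ∸ n₀) ≡ p
      p≡ = m+[n∸m]≡n (<⇒≤ (<ᵇ≡true⇒< n₀ p p∈T₁))
      same-order : ∀ i → i ∈[1, n₁ ] → (inT₁ (n₀ + i) ∧ (n₀ + i ≺[ h ] p)) ≡ (suf T₁ i <lexᵇ suf T₁ (p ∸ n₀))
      same-order i i∈ rewrite inT₁-n₀+ (proj₁ i∈) =
        trans (trans (cong (λ b → order h (Suf (n₀ + i)) true (Suf p) b) p∈T₁) (order-same h (Suf (n₀ + i)) true (Suf p)))
              (sym (cong₂ _<lexᵇ_ (suf-T₁ i (proj₁ i∈))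
                                  (trans (suf-T₁ (p ∸ n₀) (m<n⇒0<n∸m (<ᵇ≡true⇒< n₀ p p∈T₁))) (cong Suf p≡))))

    F₀ : ℕ → ℕ
    F₀ c = suc (countLess c (bwtList T₀ sa₀) + countLess c (bwtList T₁ sa₁))

    F₀≡C : ∀ c → F₀ c ≡ C c
    F₀≡C c = cong suc (begin
        countLess c (bwtList T₀ sa₀) + countLess c (bwtList T₁ sa₁)
          ≡⟨ cong₂ _+_ (countLess-applyUpTo c (λ i → BWT T₀ sa₀ (suc i)) (λ i → i) n₀)
                       (countLess-applyUpTo c (λ i → BWT T₁ sa₁ (suc i)) (λ i → i) n₁) ⟩
        count n₀ (λ i → BWT T₀ sa₀ (suc (i ∸ 1)) <ᵇ c) + count n₁ (λ i → BWT T₁ sa₁ (suc (i ∸ 1)) <ᵇ c)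
          ≡⟨ cong₂ _+_ (count-cong n₀ _ _ λ { (suc i) i∈ → cong (_<ᵇ c) (BWT-T₀ sa₀ (suc i) (SA₀.sa-maps (suc i) i∈)) })
                       (count-cong n₁ _ _ λ { (suc i) i∈ → cong (_<ᵇ c) (BWT-T₁ sa₁ (suc i) (SA₁.sa-maps (suc i) i∈)) }) ⟩
        count n₀ (λ i → before (sa₀ i) <ᵇ c) + count n₁ (λ i → before (n₀ + sa₁ i) <ᵇ c)
          ≡⟨ cong₂ _+_ (count-∘-permutation SA₀.sa-maps SA₀.sa-inj (λ p → before p <ᵇ c))
                       (count-∘-permutation SA₁.sa-maps SA₁.sa-inj (λ i → before (n₀ + i) <ᵇ c)) ⟩
        count n₀ (λ p → before p <ᵇ c) + count n₁ (λ i → before (n₀ + i) <ᵇ c)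
          ≡⟨ count-+ n₀ n₁ (λ p → before p <ᵇ c) ⟨
        count N (λ p → before p <ᵇ c)
          ≡⟨ count-∘-permutation prev-maps prev-inj (λ q → char q <ᵇ c) ⟩
        count N (λ q → char q <ᵇ c) ∎)
      where open ≡-Reasoning

    ∈N⇒∈T₀₁ : ∀ {r} → r ∈[1, N ] → r ∈[1, length T₀₁ ]
    ∈N⇒∈T₀₁ {r} = subst (r ∈[1,_]) (sym length-T₀₁)

    sa₀₁-maps : IsSelfMap N sa₀₁
    sa₀₁-maps i i∈ = subst (sa₀₁ i ∈[1,_]) length-T₀₁ (SA₀₁.sa-maps i (∈N⇒∈T₀₁ i∈))

    sufSA : ℕ → List ℕ
    sufSA i = Suf (sa₀₁ i)

    sufSA-sorted : ∀ i j → i ∈[1, N ] → i < j → j ≤ N → (sufSA i <lexᵇ sufSA j) ≡ true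
    sufSA-sorted i j i∈ i<j j≤N = SA₀₁.sa-sorted i j (∈N⇒∈T₀₁ i∈) i<j (subst (j ≤_) (sym length-T₀₁) j≤N)

    rank-sufSA : ∀ j → j ∈[1, N ] → suc (count N (λ q → Suf q <lexᵇ sufSA j)) ≡ j
    rank-sufSA j j∈ = subst (λ n → suc (count n (λ q → Suf q <lexᵇ sufSA j)) ≡ j) length-T₀₁
                            (SA₀₁.rank-sa j (∈N⇒∈T₀₁ j∈))

    -- The first disjunct is needed since a suffix shorter than H shares fewer
    -- than H symbols with itself.
    infix 4 _≈[_]_

    _≈[_]_ : ℕ → ℕ → ℕ → Set
    u ≈[ H ] u' = u ≡ u' ⊎ H ≤ lcp (Suf u) (Suf u')

    ≈-sym : ∀ {H u u'} → u ≈[ H ] u' → u' ≈[ H ] u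
    ≈-sym (inj₁ u≡u') = inj₁ (sym u≡u')
    ≈-sym {H} {u} {u'} (inj₂ H≤) = inj₂ (subst (H ≤_) (lcp-comm (Suf u) (Suf u')) H≤)

    ≈-lcp : ∀ {H u u' v v'} → u ≈[ H ] u' → v ≈[ H ] v' → H ≤ lcp (Suf u) (Suf v) → H ≤ lcp (Suf u') (Suf v')
    ≈-lcp {H} {u} {u'} {v} {v'} u≈ v≈ H≤uv = right v≈ (left u≈)
      where
      left : u ≈[ H ] u' → H ≤ lcp (Suf u') (Suf v)
      left (inj₁ refl) = H≤uv
      left (inj₂ H≤uu') = lcp-≥-trans H (Suf u') (Suf u) (Suf v) (subst (H ≤_) (lcp-comm (Suf u) (Suf u')) H≤uu') H≤uv
      right : v ≈[ H ] v' → H ≤ lcp (Suf u') (Suf v) → H ≤ lcp (Suf u') (Suf v')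
      right (inj₁ refl) H≤ = H≤
      right (inj₂ H≤vv') H≤ = lcp-≥-trans H (Suf u') (Suf v) (Suf v') H≤ H≤vv'

    -- Both orders sort by the first h symbols.
    sa₀₁≈pos⁻¹ : ∀ h j → j ∈[1, N ] → sa₀₁ j ≈[ h ] pos⁻¹ h j
    sa₀₁≈pos⁻¹ h j j∈ with ≡ᵇ-cases (sa₀₁ j) (pos⁻¹ h j) | <-≤-connex (lcp (sufSA j) (Suf (pos⁻¹ h j))) h
    ... | equal _ x≡y | _      = inj₁ x≡y
    ... | unequal _ _ | inj₂ h≤ = inj₂ h≤
    ... | unequal _ x≢y | inj₁ lt = ⊥-elim (different-counts same-count)
      where
      x = sa₀₁ j
      y = pos⁻¹ h j
      x∈ = sa₀₁-maps j j∈
      y∈ = pos⁻¹-maps h j j∈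
      same-count : count N (λ q → Suf q <lexᵇ Suf x) ≡ count N (λ q → q ≺[ h ] y)
      same-count = suc-injective (trans (rank-sufSA j j∈) (sym (pos∘pos⁻¹ h j j∈)))
      different-counts : ¬ count N (λ q → Suf q <lexᵇ Suf x) ≡ count N (λ q → q ≺[ h ] y)
      different-counts e with <lexᵇ-total (Suf x) (Suf y) (λ e' → x≢y (Suf-inj x y x∈ y∈ e'))
      ... | inj₁ x<y = <⇒≢ (count-mono-< N _ _ below-x x x∈ (<lexᵇ-irrefl (Suf x)) (trans (≺-< h x y lt) x<y)) e
        where
        below-x : ∀ q → q ∈[1, N ] → (Suf q <lexᵇ Suf x) ≡ true → (q ≺[ h ] y) ≡ true
        below-x q _ q<x = trans (≺-< h q y (≤-<-trans (lcp-sorted-≤ʳ (Suf q) (Suf x) (Suf y) q<x x<y) lt))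
                                (<lexᵇ-trans (Suf q) (Suf x) (Suf y) q<x x<y)
      ... | inj₂ y<x = <⇒≢ (count-mono-< N _ _ below-y y y∈ (≺-irrefl h y) y<x) (sym e)
        where
        below-y : ∀ q → q ∈[1, N ] → (q ≺[ h ] y) ≡ true → (Suf q <lexᵇ Suf x) ≡ true
        below-y q _ q≺y with <-≤-connex (lcp (Suf q) (Suf y)) h
        ... | inj₁ qy<h = <lexᵇ-trans (Suf q) (Suf y) (Suf x) (trans (sym (≺-< h q y qy<h)) q≺y) y<x
        ... | inj₂ h≤qy = trans (proj₂ (lcp-<-transferʳ (Suf q) (Suf y) (Suf x)
                                  (<-≤-trans (subst (_< h) (lcp-comm (Suf x) (Suf y)) lt) h≤qy))) y<x

    LCP₀₁ : ℕ → ℕ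
    LCP₀₁ = LCP T₀₁ sa₀₁

    lcp-from-LCP : ∀ H a b → a ∈[1, N ] → a < b → b ≤ N →
      (∀ m → a < m → m ≤ b → H ≤ LCP₀₁ m) → H ≤ lcp (sufSA a) (sufSA b)
    lcp-from-LCP H a (suc b) a∈ (s≤s a≤b) b<N H≤ with m≤n⇒m<n∨m≡n a≤b
    ... | inj₂ refl = H≤ (suc a) ≤-refl ≤-refl
    ... | inj₁ a<b  = lcp-≥-trans H (sufSA a) (sufSA b) (sufSA (suc b))
                        (lcp-from-LCP H a b a∈ a<b (≤-trans (n≤1+n b) b<N) (λ m a<m m≤b → H≤ m a<m (m≤n⇒m≤1+n m≤b)))
                        (H≤ (suc b) (s≤s a≤b) ≤-refl)

    LCP-from-lcp : ∀ H a b → a ∈[1, N ] → a < b → b ≤ N → H ≤ lcp (sufSA a) (sufSA b) →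
      ∀ m → a < m → m ≤ b → H ≤ LCP₀₁ m
    LCP-from-lcp H a b a∈ a<b b≤N H≤ (suc m) a<m m<b = ≤-trans H≤ (≤-trans shrink-left shrink-right)
      where
      m∈ : m ∈[1, N ]
      m∈ = ≤-trans (proj₁ a∈) (≤-pred a<m) , ≤-trans (n≤1+n m) (≤-trans m<b b≤N)
      shrink-left : lcp (sufSA a) (sufSA b) ≤ lcp (sufSA m) (sufSA b)
      shrink-left with m≤n⇒m<n∨m≡n (≤-pred a<m)
      ... | inj₂ refl = ≤-refl
      ... | inj₁ a<m' = lcp-sorted-≤ʳ (sufSA a) (sufSA m) (sufSA b)
                          (sufSA-sorted a m a∈ a<m' (proj₂ m∈)) (sufSA-sorted m b m∈ m<b b≤N)
      shrink-right : lcp (sufSA m) (sufSA b) ≤ lcp (sufSA m) (sufSA (suc m))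
      shrink-right with m≤n⇒m<n∨m≡n m<b
      ... | inj₂ refl = ≤-refl
      ... | inj₁ 1+m<b = lcp-sorted-≤ˡ (sufSA m) (sufSA (suc m)) (sufSA b)
                           (sufSA-sorted m (suc m) m∈ ≤-refl (≤-trans m<b b≤N))
                           (sufSA-sorted (suc m) b (s≤s z≤n , ≤-trans m<b b≤N) 1+m<b b≤N)

    sa₀₁-pos-≈ : ∀ h u → u ∈[1, N ] → sa₀₁ (pos h u) ≈[ h ] u
    sa₀₁-pos-≈ h u u∈ = subst (sa₀₁ (pos h u) ≈[ h ]_) (pos⁻¹∘pos h u u∈) (sa₀₁≈pos⁻¹ h (pos h u) (pos-maps h u u∈))

    bucket-start : ∀ h q' q → q' ∈[1, N ] → q ∈[1, N ] → suc (pos (suc h) q') ≡ pos (suc h) q →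
      pos (suc h) q ≡ C (char q) → char q' ≢ char q
    bucket-start h q' q q'∈ q∈ adjacent first same =
      <-irrefl refl (begin-strict
        pos (suc h) q'  <⟨ ≤-reflexive adjacent ⟩
        pos (suc h) q   ≡⟨ first ⟩
        C (char q)      ≡⟨ cong C same ⟨
        C (char q')     ≤⟨ C≤pos h q' q'∈ ⟩
        pos (suc h) q'  ∎)
      where open ≤-Reasoning

    bucket-same : ∀ h q' q → q' ∈[1, N ] → q ∈[1, N ] → suc (pos (suc h) q') ≡ pos (suc h) q →
      pos (suc h) q ≢ C (char q) → char q' ≡ char q
    bucket-same h q' q q'∈ q∈ adjacent not-first with <-cmp (char q') (char q)
    ... | tri≈ _ same _ = same
    ... | tri< c'<c _ _ = ⊥-elim (<-irrefl refl (begin-strict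
        pos (suc h) q'      <⟨ pos<C h q' q'∈ ⟩
        C (suc (char q'))   ≤⟨ C-mono _ _ c'<c ⟩
        C (char q)          ≤⟨ ≤-pred (subst (C (char q) <_) (sym adjacent) (≤∧≢⇒< (C≤pos h q q∈) (λ e → not-first (sym e)))) ⟩
        pos (suc h) q'      ∎))
      where open ≤-Reasoning
    ... | tri> _ _ c<c' = ⊥-elim (<-irrefl refl (begin-strict
        pos (suc h) q       <⟨ pos<C h q q∈ ⟩
        C (suc (char q))    ≤⟨ C-mono _ _ c<c' ⟩
        C (char q')         ≤⟨ C≤pos h q' q'∈ ⟩
        pos (suc h) q'      <⟨ ≤-reflexive adjacent ⟩
        pos (suc h) q       ∎))
      where open ≤-Reasoning

    -- The array B

    -- The test B[k] ≠ 0 ∧ B[k] ≠ h+1 that sets id in phase h+1.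
    opensBlock : ℕ → ℕ → Bool
    opensBlock h v = not (v ≡ᵇ 0) ∧ not (v ≡ᵇ suc h)

    -- The variable id after iteration k of phase h+1.
    blockId : ℕ → (ℕ → ℕ) → ℕ → ℕ
    blockId h B = lastMarked (λ m → opensBlock h (B m))

    expectedB : ℕ → ℕ → ℕ
    expectedB h j = if LCP₀₁ j <ᵇ h then suc (LCP₀₁ j) else 0

    BInvariant : ℕ → (ℕ → ℕ) → Set
    BInvariant h B = B 1 ≡ 1 × (∀ j → 2 ≤ j → j ≤ N → B j ≡ expectedB h j)

    opensBlock-LCP : ∀ h B → BInvariant h B → ∀ m → 2 ≤ m → m ≤ N → opensBlock h (B m) ≡ (LCP₀₁ m <ᵇ h)
    opensBlock-LCP h B (_ , B≡) m 2≤m m≤N rewrite B≡ m 2≤m m≤N with <-≤-connex (LCP₀₁ m) h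
    ... | inj₁ lt rewrite <⇒<ᵇ≡true lt | ≢⇒≡ᵇ≡false (<⇒≢ lt) = refl
    ... | inj₂ ge rewrite ≥⇒<ᵇ≡false ge = refl

    sameBlock⇒lcp : ∀ h B → BInvariant h B → ∀ k' k → k' ∈[1, N ] → k' < k → k ≤ N →
      blockId h B k' ≡ blockId h B k → h ≤ lcp (sufSA k') (sufSA k)
    sameBlock⇒lcp h B inv k' k k'∈ k'<k k≤N same = lcp-from-LCP h k' k k'∈ k'<k k≤N λ m k'<m m≤k →
      <ᵇ≡false⇒≥ (LCP₀₁ m) h
        (trans (sym (opensBlock-LCP h B inv m (≤-trans (s≤s (proj₁ k'∈)) k'<m) (≤-trans m≤k k≤N)))
               (lastMarked-≡⇒unmarked _ k' k same m k'<m m≤k))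

    lcp⇒sameBlock : ∀ h B → BInvariant h B → ∀ k' k → k' ∈[1, N ] → k' < k → k ≤ N →
      h ≤ lcp (sufSA k') (sufSA k) → blockId h B k' ≡ blockId h B k
    lcp⇒sameBlock h B inv k' k k'∈ k'<k k≤N h≤ = sym (lastMarked-const _ k' k (<⇒≤ k'<k) λ m k'<m m≤k →
      trans (opensBlock-LCP h B inv m (≤-trans (s≤s (proj₁ k'∈)) k'<m) (≤-trans m≤k k≤N))
            (≥⇒<ᵇ≡false (LCP-from-lcp h k' k k'∈ k'<k k≤N h≤ m k'<m m≤k)))

    -- The iteration of phase h+1 that writes index j of Z^(h+1).
    writer : ℕ → ℕ → ℕ
    writer h j = pos h (next (pos⁻¹ (suc h) j))

    -- Whether iteration writer h j records a new id for its symbol: j opens its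
    -- bucket, or the previous entry of the bucket was written under another id.
    newGroup : ℕ → (ℕ → ℕ) → ℕ → Bool
    newGroup h B j = if j ≡ᵇ C (char (pos⁻¹ (suc h) j)) then true
                     else not (blockId h B (writer h (j ∸ 1)) ≡ᵇ blockId h B (writer h j))

    updatedB : ℕ → (ℕ → ℕ) → ℕ → ℕ
    updatedB h B j = if (B j ≡ᵇ 0) ∧ newGroup h B j then suc h else B j

    sameBlock⇔lcp-pos : ∀ h B → BInvariant h B → ∀ u' u → u' ∈[1, N ] → u ∈[1, N ] → pos h u' < pos h u →
      (blockId h B (pos h u') ≡ blockId h B (pos h u) → h ≤ lcp (Suf u') (Suf u)) ×
      (h ≤ lcp (Suf u') (Suf u) → blockId h B (pos h u') ≡ blockId h B (pos h u))
    sameBlock⇔lcp-pos h B inv u' u u'∈ u∈ k'<k =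
      (λ same → ≈-lcp (sa₀₁-pos-≈ h u' u'∈) (sa₀₁-pos-≈ h u u∈) (sameBlock⇒lcp h B inv k' k k'∈ k'<k k≤N same)) ,
      (λ h≤ → lcp⇒sameBlock h B inv k' k k'∈ k'<k k≤N
                (≈-lcp (≈-sym (sa₀₁-pos-≈ h u' u'∈)) (≈-sym (sa₀₁-pos-≈ h u u∈)) h≤))
      where
      k' = pos h u'
      k  = pos h u
      k'∈ = pos-maps h u' u'∈
      k≤N = proj₂ (pos-maps h u u∈)

    module Adjacent (h j' : ℕ) (j'∈ : j' ∈[1, N ]) (j≤N : suc j' ≤ N) where

      j : ℕ
      j = suc j'

      j∈ : j ∈[1, N ]
      j∈ = s≤s z≤n , j≤N

      q q' : ℕ
      q  = pos⁻¹ (suc h) j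
      q' = pos⁻¹ (suc h) j'

      q∈ : q ∈[1, N ]
      q∈ = pos⁻¹-maps (suc h) j j∈

      q'∈ : q' ∈[1, N ]
      q'∈ = pos⁻¹-maps (suc h) j' j'∈

      adjacent : suc (pos (suc h) q') ≡ pos (suc h) q
      adjacent = trans (cong suc (pos∘pos⁻¹ (suc h) j' j'∈)) (sym (pos∘pos⁻¹ (suc h) j j∈))

      LCP⇒lcp : suc h ≤ LCP₀₁ j → suc h ≤ lcp (Suf q') (Suf q)
      LCP⇒lcp = ≈-lcp (sa₀₁≈pos⁻¹ (suc h) j' j'∈) (sa₀₁≈pos⁻¹ (suc h) j j∈)

      lcp⇒LCP : suc h ≤ lcp (Suf q') (Suf q) → suc h ≤ LCP₀₁ j
      lcp⇒LCP = ≈-lcp (≈-sym (sa₀₁≈pos⁻¹ (suc h) j' j'∈)) (≈-sym (sa₀₁≈pos⁻¹ (suc h) j j∈))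

      newGroup-first : ∀ B → j ≡ C (char q) → newGroup h B j ≡ (LCP₀₁ j <ᵇ suc h)
      newGroup-first B j≡C = trans (if-true (≡⇒≡ᵇ≡true j≡C)) (sym (<⇒<ᵇ≡true LCP<))
        where
        other-symbol : char q' ≢ char q
        other-symbol = bucket-start h q' q q'∈ q∈ adjacent (trans (pos∘pos⁻¹ (suc h) j j∈) j≡C)
        LCP< : LCP₀₁ j < suc h
        LCP< = [ (λ lt → lt) , (λ ge → ⊥-elim (n≮0 (subst (suc h ≤_) lcp≡0 (LCP⇒lcp ge)))) ]′ (<-≤-connex (LCP₀₁ j) (suc h))
          where
          lcp≡0 : lcp (Suf q') (Suf q) ≡ 0
          lcp≡0 = trans (cong₂ lcp (Suf-∷ q' q'∈) (Suf-∷ q q∈)) (lcp-∷-≢ (Suf (suc q')) (Suf (suc q)) other-symbol)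

      newGroup-inner : ∀ B → BInvariant h B → j ≢ C (char q) → newGroup h B j ≡ (LCP₀₁ j <ᵇ suc h)
      newGroup-inner B inv j≢C = trans (if-false (≢⇒≡ᵇ≡false j≢C)) (not-≡ᵇ≡<ᵇ _ _ _ _ same⇒LCP LCP⇒same)
        where
        c = char q
        same-symbol : char q' ≡ c
        same-symbol = bucket-same h q' q q'∈ q∈ adjacent (λ e → j≢C (trans (sym (pos∘pos⁻¹ (suc h) j j∈)) e))
        c≥2 : 2 ≤ c
        c≥2 = [ (λ c<2 → ⊥-elim (<-irrefl (cong (pos (suc h)) (char<2-unique q' q q'∈ q∈ same-symbol c<2)) (≤-reflexive adjacent)))
              , (λ c≥2 → c≥2) ]′ (<-≤-connex c 2)
        u' = next q'
        u  = next q
        lcp-q : lcp (Suf q') (Suf q) ≡ suc (lcp (Suf u') (Suf u))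
        lcp-q = trans (cong₂ lcp (trans (Suf-next q' q'∈ (subst (2 ≤_) (sym same-symbol) c≥2)) (cong (_∷ Suf u') same-symbol))
                                 (Suf-next q q∈ c≥2))
                      (lcp-∷ c (Suf u') (Suf u))
        u'≺u : (u' ≺[ h ] u) ≡ true
        u'≺u = trans (sym (≺-LF h u q' (next-maps q q∈) q'∈ (trans same-symbol (cong char (sym (prev∘next q q∈))))))
                     (trans (cong (q' ≺[ suc h ]_) (prev∘next q q∈)) (pos-<⇒≺ (suc h) q' q q'∈ q∈ (≤-reflexive adjacent)))
        same⇔ = sameBlock⇔lcp-pos h B inv u' u (next-maps q' q'∈) (next-maps q q∈) (pos-mono h u' u (next-maps q' q'∈) u'≺u)
        same⇒LCP : blockId h B (pos h u') ≡ blockId h B (pos h u) → suc h ≤ LCP₀₁ j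
        same⇒LCP same = lcp⇒LCP (subst (suc h ≤_) (sym lcp-q) (s≤s (proj₁ same⇔ same)))
        LCP⇒same : suc h ≤ LCP₀₁ j → blockId h B (pos h u') ≡ blockId h B (pos h u)
        LCP⇒same h<LCP = proj₂ same⇔ (≤-pred (subst (suc h ≤_) lcp-q (LCP⇒lcp h<LCP)))

    updatedB-correct : ∀ h B → BInvariant h B → ∀ j → 2 ≤ j → j ≤ N → updatedB h B j ≡ expectedB (suc h) j
    updatedB-correct h B inv (suc j') (s≤s 1≤j') j≤N =
      B-update (LCP₀₁ j) h (B j) (newGroup h B j) (proj₂ inv j (s≤s 1≤j') j≤N) newGroup-correct
      where
      open Adjacent h j' (1≤j' , ≤-trans (n≤1+n j') j≤N) j≤N
      newGroup-correct : newGroup h B j ≡ (LCP₀₁ j <ᵇ suc h)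
      newGroup-correct with ≡ᵇ-cases j (C (char q))
      ... | equal _ j≡C   = newGroup-first B j≡C
      ... | unequal _ j≢C = newGroup-inner B inv j≢C

    -- The main loop

    zbit : ℕ → ℕ
    zbit p = if inT₁ p then 1 else 0

    zbit≡ᵇ0 : ∀ p → (zbit p ≡ᵇ 0) ≡ not (inT₁ p)
    zbit≡ᵇ0 p with inT₁ p
    ... | true  = refl
    ... | false = refl

    ZInvariant : ℕ → (ℕ → ℕ) → Set
    ZInvariant h Z = ∀ j → j ∈[1, N ] → Z j ≡ zbit (pos⁻¹ h j)

    writer-maps : ∀ h → IsSelfMap N (writer h)
    writer-maps h j j∈ = pos-maps h _ (next-maps _ (pos⁻¹-maps (suc h) j j∈))

    opensBlock-updatedB : ∀ h B j → opensBlock h (updatedB h B j) ≡ opensBlock h (B j)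
    opensBlock-updatedB h B j with B j | newGroup h B j
    ... | zero  | true  rewrite ≡ᵇ-refl h = refl
    ... | zero  | false = refl
    ... | suc v | _     = refl

    -- Phase h+1, run on the arrays Z^(h) and B left by phase h.
    module Phase (h : ℕ) (Zprev Bprev : ℕ → ℕ) (zinv : ZInvariant h Zprev) (binv : BInvariant h Bprev) where

      record LoopInvariant (done : ℕ) (s : St) : Set where
        field
          k₀-count   : St.k0 s ≡ suc (count done (λ m → Zprev m ≡ᵇ 0))
          k₁-count   : St.k1 s ≡ suc (count done (λ m → not (Zprev m ≡ᵇ 0)))
          F-count    : ∀ c → St.F s c ≡ C c + count done (λ m → before (pos⁻¹ h m) ≡ᵇ c)
          id-current : St.cid s ≡ blockId h Bprev done
          Bid-last   : ∀ c → St.Bid s c ≡ (if St.F s c ≡ᵇ C c then nothing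
                                           else just (blockId h Bprev (writer h (St.F s c ∸ 1))))
          Z-written  : ∀ j → j ∈[1, N ] → writer h j ≤ done → St.Z s j ≡ zbit (pos⁻¹ (suc h) j)
          B-written  : ∀ j → j ∈[1, N ] → writer h j ≤ done → St.B s j ≡ updatedB h Bprev j
          B-pending  : ∀ j → ¬ (j ∈[1, N ] × writer h j ≤ done) → St.B s j ≡ Bprev j

      initial : St
      initial = st 0 1 1 F₀ (λ _ → nothing) (λ _ → 0) Bprev

      initial-invariant : LoopInvariant 0 initial
      initial-invariant = record
        { k₀-count   = refl
        ; k₁-count   = refl
        ; F-count    = λ c → trans (F₀≡C c) (sym (+-identityʳ (C c)))
        ; id-current = refl
        ; Bid-last   = λ c → sym (if-true (≡⇒≡ᵇ≡true (F₀≡C c)))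
        ; Z-written  = λ j j∈ w≤0 → ⊥-elim (never-written j j∈ w≤0)
        ; B-written  = λ j j∈ w≤0 → ⊥-elim (never-written j j∈ w≤0)
        ; B-pending  = λ _ _ → refl }
        where
        never-written : ∀ j → j ∈[1, N ] → ¬ writer h j ≤ 0
        never-written j j∈ w≤0 = ∈-empty (proj₁ (writer-maps h j j∈) , w≤0)

      -- Iteration k = done + 1 of the loop.
      module Iteration (done : ℕ) (k∈ : suc done ∈[1, N ])
                       (id k₀ k₁ : ℕ) (F : ℕ → ℕ) (Bid : ℕ → Maybe ℕ) (Z B : ℕ → ℕ)
                       (I : LoopInvariant done (st id k₀ k₁ F Bid Z B)) where
        open LoopInvariant I

        k = suc done
        b = Zprev k
        c = if b ≡ᵇ 0 then BWT T₀ sa₀ k₀ else BWT T₁ sa₁ k₁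
        j = F c
        id' = if opensBlock h (B k) then k else id
        sm = sameId (Bid c) id'

        p = pos⁻¹ h k
        p∈ = pos⁻¹-maps h k k∈
        pos-p : pos h p ≡ k
        pos-p = pos∘pos⁻¹ h k k∈

        count-done : ∀ (R Q : ℕ → Bool) → (∀ m → m ∈[1, N ] → R m ≡ Q (pos⁻¹ h m)) →
          count done R ≡ count N (λ q → (q ≺[ h ] p) ∧ Q q)
        count-done R Q R≡ = begin
          count done R
            ≡⟨ count-prefix N k R (m≤n⇒m≤1+n (proj₂ k∈)) ⟨
          count N (λ m → (m <ᵇ k) ∧ R m)
            ≡⟨ count-cong N _ _ (λ m m∈ → cong₂ (λ x y → (m <ᵇ x) ∧ y) (sym pos-p) (R≡ m m∈)) ⟩
          count N (λ m → (m <ᵇ pos h p) ∧ Q (pos⁻¹ h m))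
            ≡⟨ count-before-pos h Q p p∈ ⟩
          count N (λ q → (q ≺[ h ] p) ∧ Q q) ∎
          where open ≡-Reasoning

        b≡ᵇ0 : (b ≡ᵇ 0) ≡ not (inT₁ p)
        b≡ᵇ0 = trans (cong (_≡ᵇ 0) (zinv k k∈)) (zbit≡ᵇ0 p)

        symbol-read : c ≡ before p
        symbol-read with inT₁ p in p∈T₁?
        ... | false = begin
            c                                ≡⟨ if-true (trans b≡ᵇ0 (cong not p∈T₁?)) ⟩
            BWT T₀ sa₀ k₀                    ≡⟨ cong (BWT T₀ sa₀) k₀≡rank ⟩
            BWT T₀ sa₀ (SA₀.rank p)          ≡⟨ BWT-T₀ sa₀ (SA₀.rank p) (SA₀.sa-maps _ (SA₀.rank-maps p p∈₀)) ⟩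
            before (sa₀ (SA₀.rank p))        ≡⟨ cong before (SA₀.sa-rank p p∈₀) ⟩
            before p                         ∎
          where
          open ≡-Reasoning
          p∈₀ : p ∈[1, n₀ ]
          p∈₀ = proj₁ p∈ , <ᵇ≡false⇒≥ n₀ p p∈T₁?
          k₀≡rank : k₀ ≡ SA₀.rank p
          k₀≡rank = trans k₀-count (cong suc (trans
            (count-done _ (not ∘ inT₁) (λ m m∈ → trans (cong (_≡ᵇ 0) (zinv m m∈)) (zbit≡ᵇ0 (pos⁻¹ h m))))
            (trans (count-cong N _ _ (λ q _ → ∧-comm (q ≺[ h ] p) _)) (suc-injective (sym (rank₀ h p p∈ p∈T₁?))))))
        ... | true = begin
            c                                ≡⟨ if-false (trans b≡ᵇ0 (cong not p∈T₁?)) ⟩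
            BWT T₁ sa₁ k₁                    ≡⟨ cong (BWT T₁ sa₁) k₁≡rank ⟩
            BWT T₁ sa₁ (SA₁.rank i)          ≡⟨ BWT-T₁ sa₁ (SA₁.rank i) (SA₁.sa-maps _ (SA₁.rank-maps i i∈₁)) ⟩
            before (n₀ + sa₁ (SA₁.rank i))   ≡⟨ cong (λ r → before (n₀ + r)) (SA₁.sa-rank i i∈₁) ⟩
            before (n₀ + i)                  ≡⟨ cong before n₀+i≡p ⟩
            before p                         ∎
          where
          open ≡-Reasoning
          i = p ∸ n₀
          n₀<p = <ᵇ≡true⇒< n₀ p p∈T₁?
          n₀+i≡p : n₀ + i ≡ p
          n₀+i≡p = m+[n∸m]≡n (<⇒≤ n₀<p)
          i∈₁ : i ∈[1, n₁ ]
          i∈₁ = m<n⇒0<n∸m n₀<p , +-cancelˡ-≤ n₀ i n₁ (subst (_≤ N) (sym n₀+i≡p) (proj₂ p∈))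
          k₁≡rank : k₁ ≡ SA₁.rank i
          k₁≡rank = trans k₁-count (cong suc (trans
            (count-done _ inT₁ (λ m m∈ → trans (cong (λ z → not (z ≡ᵇ 0)) (zinv m m∈))
                                               (trans (cong not (zbit≡ᵇ0 (pos⁻¹ h m))) (not-involutive _))))
            (trans (count-cong N _ _ (λ q _ → ∧-comm (q ≺[ h ] p) _)) (suc-injective (sym (rank₁ h p p∈ p∈T₁?))))))

        index-written : j ≡ pos (suc h) (prev p)
        index-written = begin
          F c
            ≡⟨ F-count c ⟩
          C c + count done (λ m → before (pos⁻¹ h m) ≡ᵇ c)
            ≡⟨ cong (λ x → C x + count done (λ m → before (pos⁻¹ h m) ≡ᵇ x)) symbol-read ⟩
          C (before p) + count done (λ m → before (pos⁻¹ h m) ≡ᵇ before p)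
            ≡⟨ cong (C (before p) +_) (count-done _ (λ q → before q ≡ᵇ before p) (λ _ _ → refl)) ⟩
          C (before p) + count N (λ q → (q ≺[ h ] p) ∧ (before q ≡ᵇ before p))
            ≡⟨ pos-LF h p p∈ ⟨
          pos (suc h) (prev p) ∎
          where open ≡-Reasoning

        j∈ : j ∈[1, N ]
        j∈ = subst (_∈[1, N ]) (sym index-written) (pos-maps (suc h) (prev p) (prev-maps p p∈))

        pos⁻¹-j : pos⁻¹ (suc h) j ≡ prev p
        pos⁻¹-j = trans (cong (pos⁻¹ (suc h)) index-written) (pos⁻¹∘pos (suc h) (prev p) (prev-maps p p∈))

        writer-j : writer h j ≡ k
        writer-j = trans (cong (pos h ∘ next) pos⁻¹-j) (trans (cong (pos h) (next∘prev p p∈)) pos-p)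

        written-now⇒j : ∀ j' → j' ∈[1, N ] → writer h j' ≡ k → j' ≡ j
        written-now⇒j j' j'∈ writer≡k = begin
          j'                             ≡⟨ pos∘pos⁻¹ (suc h) j' j'∈ ⟨
          pos (suc h) o                  ≡⟨ cong (pos (suc h)) (prev∘next o o∈) ⟨
          pos (suc h) (prev (next o))    ≡⟨ cong (pos (suc h) ∘ prev) next-o≡p ⟩
          pos (suc h) (prev p)           ≡⟨ index-written ⟨
          j                              ∎
          where
          open ≡-Reasoning
          o = pos⁻¹ (suc h) j'
          o∈ = pos⁻¹-maps (suc h) j' j'∈
          next-o≡p : next o ≡ p
          next-o≡p = pos-inj h (next o) p (next-maps o o∈) p∈ (trans writer≡k (sym pos-p))

        written-before : ∀ j' → j' ∈[1, N ] → writer h j' ≤ k → j' ≢ j → writer h j' ≤ done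
        written-before j' j'∈ w≤k j'≢j = ≤-pred (≤∧≢⇒< w≤k (λ w≡k → j'≢j (written-now⇒j j' j'∈ w≡k)))

        C≤j : C c ≤ j
        C≤j = subst (C c ≤_) (sym (F-count c)) (m≤m+n (C c) _)

        id'≡ : id' ≡ blockId h Bprev k
        id'≡ = cong₂ (λ x y → if x then k else y) opensBlock-B-k id-current
          where
          opensBlock-B-k : opensBlock h (B k) ≡ opensBlock h (Bprev k)
          opensBlock-B-k = [ (λ w≤done → trans (cong (opensBlock h) (B-written k k∈ w≤done)) (opensBlock-updatedB h Bprev k))
                           , (λ done<w → cong (opensBlock h) (B-pending k (λ (_ , w≤done) → <⇒≱ done<w w≤done))) ]′
                           (≤-<-connex (writer h k) done)

        newGroup≡not-sm : newGroup h Bprev j ≡ not sm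
        newGroup≡not-sm = begin
          newGroup h Bprev j
            ≡⟨ cong (λ x → if j ≡ᵇ C x then true else not (A ≡ᵇ blockId h Bprev (writer h j))) char-pos⁻¹-j ⟩
          (if j ≡ᵇ C c then true else not (A ≡ᵇ blockId h Bprev (writer h j)))
            ≡⟨ cong (λ d → if j ≡ᵇ C c then true else not (A ≡ᵇ d)) (trans (cong (blockId h Bprev) writer-j) (sym id'≡)) ⟩
          (if j ≡ᵇ C c then true else not (A ≡ᵇ id'))
            ≡⟨ sameId-if (j ≡ᵇ C c) A id' ⟩
          not (sameId (if j ≡ᵇ C c then nothing else just A) id')
            ≡⟨ cong (λ m → not (sameId m id')) (Bid-last c) ⟨
          not sm ∎
          where
          open ≡-Reasoning
          A = blockId h Bprev (writer h (j ∸ 1))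
          char-pos⁻¹-j : char (pos⁻¹ (suc h) j) ≡ c
          char-pos⁻¹-j = trans (cong char pos⁻¹-j) (sym symbol-read)
          sameId-if : ∀ x a d → (if x then true else not (a ≡ᵇ d)) ≡ not (sameId (if x then nothing else just a) d)
          sameId-if true  a d = refl
          sameId-if false a d = refl

        k₀' k₁' : ℕ
        k₀' = if b ≡ᵇ 0 then suc k₀ else k₀
        k₁' = if b ≡ᵇ 0 then k₁ else suc k₁

        F' : ℕ → ℕ
        F' = upd F c (suc j)

        Z' : ℕ → ℕ
        Z' = upd Z j b

        k₀'-count : k₀' ≡ suc (count k (λ m → Zprev m ≡ᵇ 0))
        k₀'-count = trans (bit-if-suc (b ≡ᵇ 0) k₀) (trans (cong (bit (b ≡ᵇ 0) +_) k₀-count) (+-suc _ _))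

        k₁'-count : k₁' ≡ suc (count k (λ m → not (Zprev m ≡ᵇ 0)))
        k₁'-count = trans (bit-if-suc-not (b ≡ᵇ 0) k₁) (trans (cong (bit (not (b ≡ᵇ 0)) +_) k₁-count) (+-suc _ _))

        F'-count : ∀ c' → F' c' ≡ C c' + count k (λ m → before (pos⁻¹ h m) ≡ᵇ c')
        F'-count = at-or-away c at-c away
          where
          at-c : F' c ≡ C c + count k (λ m → before (pos⁻¹ h m) ≡ᵇ c)
          at-c = begin
            F' c                                                          ≡⟨ upd-at F c (suc j) ⟩
            suc (F c)                                                     ≡⟨ cong suc (F-count c) ⟩
            suc (C c + count done (λ m → before (pos⁻¹ h m) ≡ᵇ c))        ≡⟨ +-suc (C c) _ ⟨
            C c + (bit true + count done (λ m → before (pos⁻¹ h m) ≡ᵇ c)) ≡⟨ cong (λ x → C c + (bit x + count done (λ m → before (pos⁻¹ h m) ≡ᵇ c))) (≡⇒≡ᵇ≡true (sym symbol-read)) ⟨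
            C c + count k (λ m → before (pos⁻¹ h m) ≡ᵇ c)                 ∎
            where open ≡-Reasoning
          away : ∀ c' → c' ≢ c → F' c' ≡ C c' + count k (λ m → before (pos⁻¹ h m) ≡ᵇ c')
          away c' c'≢c = trans (upd-away F (suc j) c'≢c)
            (trans (F-count c') (cong (λ x → C c' + (bit x + count done (λ m → before (pos⁻¹ h m) ≡ᵇ c'))) (sym (≢⇒≡ᵇ≡false (λ p≡c' → c'≢c (trans (sym p≡c') (sym symbol-read)))))))

        Bid'-last : ∀ (Bid' : ℕ → Maybe ℕ) → (∀ c' → c' ≢ c → Bid' c' ≡ Bid c') → Bid' c ≡ just id' →
          ∀ c' → Bid' c' ≡ (if F' c' ≡ᵇ C c' then nothing else just (blockId h Bprev (writer h (F' c' ∸ 1))))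
        Bid'-last Bid' unchanged at-c = at-or-away c (begin
            Bid' c
              ≡⟨ at-c ⟩
            just id'
              ≡⟨ cong just (trans id'≡ (cong (blockId h Bprev) (sym writer-j))) ⟩
            just (blockId h Bprev (writer h j))
              ≡⟨ if-false (≢⇒≡ᵇ≡false {suc j} {C c} (λ e → 1+n≰n (≤-trans (≤-reflexive e) C≤j))) ⟨
            (if suc j ≡ᵇ C c then nothing else just (blockId h Bprev (writer h j)))
              ≡⟨ cong (λ v → if v ≡ᵇ C c then nothing else just (blockId h Bprev (writer h (v ∸ 1)))) (upd-at F c (suc j)) ⟨
            (if F' c ≡ᵇ C c then nothing else just (blockId h Bprev (writer h (F' c ∸ 1)))) ∎)
          λ c' c'≢c → trans (unchanged c' c'≢c)
            (trans (Bid-last c') (cong (λ v → if v ≡ᵇ C c' then nothing else just (blockId h Bprev (writer h (v ∸ 1))))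
                                       (sym (upd-away F (suc j) c'≢c))))
          where open ≡-Reasoning

        Z'-written : ∀ j' → j' ∈[1, N ] → writer h j' ≤ k → Z' j' ≡ zbit (pos⁻¹ (suc h) j')
        Z'-written = at-or-away j (λ _ _ → begin
            Z' j                     ≡⟨ upd-at Z j b ⟩
            b                        ≡⟨ zinv k k∈ ⟩
            zbit p                   ≡⟨ cong (λ x → if x then 1 else 0) (inT₁-prev p p∈) ⟨
            zbit (prev p)            ≡⟨ cong zbit pos⁻¹-j ⟨
            zbit (pos⁻¹ (suc h) j)   ∎)
          λ j' j'≢j j'∈ w≤k → trans (upd-away Z b j'≢j) (Z-written j' j'∈ (written-before j' j'∈ w≤k j'≢j))
          where open ≡-Reasoning

        B'-invariant : ∀ (B' : ℕ → ℕ) → (∀ j' → j' ≢ j → B' j' ≡ B j') → B' j ≡ updatedB h Bprev j →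
          (∀ j' → j' ∈[1, N ] → writer h j' ≤ k → B' j' ≡ updatedB h Bprev j') ×
          (∀ j' → ¬ (j' ∈[1, N ] × writer h j' ≤ k) → B' j' ≡ Bprev j')
        B'-invariant B' unchanged at-j =
          at-or-away j (λ _ _ → at-j)
            (λ j' j'≢j j'∈ w≤k → trans (unchanged j' j'≢j) (B-written j' j'∈ (written-before j' j'∈ w≤k j'≢j))) ,
          at-or-away j (λ not-yet → ⊥-elim (not-yet (j∈ , ≤-reflexive writer-j)))
            (λ j' j'≢j not-yet → trans (unchanged j' j'≢j)
                                       (B-pending j' (λ (j'∈ , w≤done) → not-yet (j'∈ , m≤n⇒m≤1+n w≤done))))

        B-j : B j ≡ Bprev j
        B-j = B-pending j (λ (_ , w≤done) → <⇒≱ (≤-reflexive (sym writer-j)) w≤done)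

        invariant-if-same : sm ≡ true → LoopInvariant k (st id' k₀' k₁' F' Bid Z' B)
        invariant-if-same sm≡true = record
          { k₀-count = k₀'-count ; k₁-count = k₁'-count ; F-count = F'-count ; id-current = id'≡
          ; Bid-last = Bid'-last Bid (λ _ _ → refl) (sameId-true (Bid c) id' sm≡true)
          ; Z-written = Z'-written
          ; B-written = proj₁ B-ok ; B-pending = proj₂ B-ok }
          where
          no-update : B j ≡ updatedB h Bprev j
          no-update = trans B-j (sym (if-false (trans (cong ((Bprev j ≡ᵇ 0) ∧_) (trans newGroup≡not-sm (cong not sm≡true)))
                                                      (∧-zeroʳ (Bprev j ≡ᵇ 0)))))
          B-ok = B'-invariant B (λ _ _ → refl) no-update

        invariant-if-new : sm ≡ false →
          LoopInvariant k (st id' k₀' k₁' F' (upd Bid c (just id')) Z' (if B j ≡ᵇ 0 then upd B j (suc h) else B))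
        invariant-if-new sm≡false = record
          { k₀-count = k₀'-count ; k₁-count = k₁'-count ; F-count = F'-count ; id-current = id'≡
          ; Bid-last = Bid'-last (upd Bid c (just id')) (λ c' c'≢c → if-false (≢⇒≡ᵇ≡false c'≢c)) (if-true (≡ᵇ-refl c))
          ; Z-written = Z'-written
          ; B-written = proj₁ B-ok ; B-pending = proj₂ B-ok }
          where
          B' = if B j ≡ᵇ 0 then upd B j (suc h) else B
          newGroup-true : newGroup h Bprev j ≡ true
          newGroup-true = trans newGroup≡not-sm (cong not sm≡false)
          updated : B' j ≡ updatedB h Bprev j
          updated = begin
            B' j                                              ≡⟨ upd-if-at (B j ≡ᵇ 0) B j (suc h) ⟩
            (if B j ≡ᵇ 0 then suc h else B j)                 ≡⟨ cong (λ v → if v ≡ᵇ 0 then suc h else v) B-j ⟩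
            (if Bprev j ≡ᵇ 0 then suc h else Bprev j)         ≡⟨ cong (λ x → if x then suc h else Bprev j) (∧-identityʳ _) ⟨
            (if (Bprev j ≡ᵇ 0) ∧ true then suc h else Bprev j) ≡⟨ cong (λ m → if (Bprev j ≡ᵇ 0) ∧ m then suc h else Bprev j) newGroup-true ⟨
            updatedB h Bprev j                                ∎
            where open ≡-Reasoning
          B-ok = B'-invariant B' (λ j' → upd-if-away (B j ≡ᵇ 0) B (suc h)) updated

        preserved : LoopInvariant k (step (BWT T₀ sa₀) (BWT T₁ sa₁) (suc h) Zprev k (st id k₀ k₁ F Bid Z B))
        preserved = by-cases sm _ _ invariant-if-same invariant-if-new
          where
          by-cases : ∀ x s₁ s₂ → (x ≡ true → LoopInvariant k s₁) → (x ≡ false → LoopInvariant k s₂) →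
            LoopInvariant k (if x then s₁ else s₂)
          by-cases true  _ _ I₁ _  = I₁ refl
          by-cases false _ _ _  I₂ = I₂ refl

      run : ∀ m done s → done + m ≡ N → LoopInvariant done s →
        LoopInvariant N (loop (BWT T₀ sa₀) (BWT T₁ sa₁) (suc h) Zprev m (suc done) s)
      run zero    done s done≡N I = subst (λ d → LoopInvariant d s) (trans (sym (+-identityʳ done)) done≡N) I
      run (suc m) done (st id k₀ k₁ F Bid Z B) done+m≡N I =
        run m (suc done) _ (trans (sym (+-suc done m)) done+m≡N) (Iteration.preserved done k∈ id k₀ k₁ F Bid Z B I)
        where k∈ = s≤s z≤n , subst (suc done ≤_) done+m≡N (≤-trans (s≤s (m≤m+n done m)) (≤-reflexive (sym (+-suc done m))))

    Zafter : ℕ → ℕ → ℕ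
    Zafter h = proj₁ (phases T₀ T₁ sa₀ sa₁ h)

    phase-step : ∀ h → ZInvariant h (Zafter h) → BInvariant h (Bafter T₀ T₁ sa₀ sa₁ h) →
      ZInvariant (suc h) (Zafter (suc h)) × BInvariant (suc h) (Bafter T₀ T₁ sa₀ sa₁ (suc h))
    phase-step h zinv binv = Z-ok , B1-ok , Bj-ok
      where
      open Phase h (Zafter h) (Bafter T₀ T₁ sa₀ sa₁ h) zinv binv
      I : LoopInvariant N (loop (BWT T₀ sa₀) (BWT T₁ sa₁) (suc h) (Zafter h) N 1 initial)
      I = run N 0 initial refl initial-invariant
      open LoopInvariant I
      all-written : ∀ j → j ∈[1, N ] → writer h j ≤ N
      all-written j j∈ = proj₂ (writer-maps h j j∈)
      Z-ok : ZInvariant (suc h) (Zafter (suc h))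
      Z-ok j j∈ = Z-written j j∈ (all-written j j∈)
      B1-ok : Bafter T₀ T₁ sa₀ sa₁ (suc h) 1 ≡ 1
      B1-ok = trans (B-written 1 1∈ (all-written 1 1∈)) (cong (λ v → if (v ≡ᵇ 0) ∧ newGroup h (Bafter T₀ T₁ sa₀ sa₁ h) 1 then suc h else v) (proj₁ binv))
        where 1∈ = ≤-refl , ≤-trans 1≤n₀ (<⇒≤ n₀<N)
      Bj-ok : ∀ j → 2 ≤ j → j ≤ N → Bafter T₀ T₁ sa₀ sa₁ (suc h) j ≡ expectedB (suc h) j
      Bj-ok j 2≤j j≤N = trans (B-written j j∈ (all-written j j∈)) (updatedB-correct h (Bafter T₀ T₁ sa₀ sa₁ h) binv j 2≤j j≤N)
        where j∈ = ≤-trans (s≤s z≤n) 2≤j , j≤N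

    pos₀-T₀ : ∀ p → p ∈[1, N ] → inT₁ p ≡ false → pos 0 p ≤ n₀
    pos₀-T₀ p p∈ p∉T₁ = begin
        suc (count N (λ q → q ≺[ 0 ] p))
          ≡⟨ cong suc (count-+ n₀ n₁ _) ⟩
        suc (count n₀ (λ q → q ≺[ 0 ] p) + count n₁ (λ i → n₀ + i ≺[ 0 ] p))
          ≡⟨ cong (λ x → suc (count n₀ (λ q → q ≺[ 0 ] p) + x)) (count-none n₁ _ T₁-after) ⟩
        suc (count n₀ (λ q → q ≺[ 0 ] p) + 0)
          ≡⟨ cong suc (+-identityʳ _) ⟩
        suc (count n₀ (λ q → q ≺[ 0 ] p))
          ≤⟨ count-< n₀ _ p (proj₁ p∈ , <ᵇ≡false⇒≥ n₀ p p∉T₁) (≺-irrefl 0 p) ⟩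
        n₀ ∎
      where
      open ≤-Reasoning
      T₁-after : ∀ i → i ∈[1, n₁ ] → (n₀ + i ≺[ 0 ] p) ≡ false
      T₁-after i i∈ rewrite inT₁-n₀+ (proj₁ i∈) | p∉T₁ = refl

    pos₀-T₁ : ∀ p → p ∈[1, N ] → inT₁ p ≡ true → n₀ < pos 0 p
    pos₀-T₁ p p∈ p∈T₁ = s≤s (begin
        n₀
          ≡⟨ count-all n₀ _ T₀-before ⟨
        count n₀ (λ q → q ≺[ 0 ] p)
          ≤⟨ m≤m+n _ _ ⟩
        count n₀ (λ q → q ≺[ 0 ] p) + count n₁ (λ i → n₀ + i ≺[ 0 ] p)
          ≡⟨ count-+ n₀ n₁ _ ⟨
        count N (λ q → q ≺[ 0 ] p) ∎)
      where
      open ≤-Reasoning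
      T₀-before : ∀ q → q ∈[1, n₀ ] → (q ≺[ 0 ] p) ≡ true
      T₀-before q q∈ rewrite inT₁-≤ (proj₂ q∈) | p∈T₁ = refl

    phase-zero : ZInvariant 0 (Zafter 0) × BInvariant 0 (Bafter T₀ T₁ sa₀ sa₁ 0)
    phase-zero = Z-ok , refl , B-ok
      where
      B-ok : ∀ j → 2 ≤ j → j ≤ N → Bafter T₀ T₁ sa₀ sa₁ 0 j ≡ expectedB 0 j
      B-ok j 2≤j j≤N rewrite ≢⇒≡ᵇ≡false {j} {1} (λ j≡1 → <⇒≢ 2≤j (sym j≡1))
                           | ≢⇒≡ᵇ≡false {j} {suc N} (λ j≡ → 1+n≰n (subst (_≤ N) j≡ j≤N)) = refl
      Z-ok : ZInvariant 0 (Zafter 0)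
      Z-ok j j∈ with inT₁ (pos⁻¹ 0 j) in e
      ... | false = if-true (<⇒<ᵇ≡true (s≤s (subst (_≤ n₀) (pos∘pos⁻¹ 0 j j∈) (pos₀-T₀ _ (pos⁻¹-maps 0 j j∈) e))))
      ... | true  = if-false (≥⇒<ᵇ≡false (subst (n₀ <_) (pos∘pos⁻¹ 0 j j∈) (pos₀-T₁ _ (pos⁻¹-maps 0 j j∈) e)))

    phase-invariant : ∀ h → ZInvariant h (Zafter h) × BInvariant h (Bafter T₀ T₁ sa₀ sa₁ h)
    phase-invariant zero    = phase-zero
    phase-invariant (suc h) = phase-step h (proj₁ (phase-invariant h)) (proj₂ (phase-invariant h))

    B-after-phase : ∀ h j → 2 ≤ j → j ≤ N → LCP₀₁ j < h → Bafter T₀ T₁ sa₀ sa₁ h j ≡ suc (LCP₀₁ j)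
    B-after-phase h j 2≤j j≤N LCP<h = trans (proj₂ (proj₂ (phase-invariant h)) j 2≤j j≤N) (if-true (<⇒<ᵇ≡true LCP<h))

corollary1 : (w0 w1 : List ℕ) → All (2 ≤_) w0 → All (2 ≤_) w1 →
    (sa0 sa1 sa01 : ℕ → ℕ) →
    IsSA (w0 ++ [ 0 ]) sa0 → IsSA (w1 ++ [ 1 ]) sa1 →
    IsSA ((w0 ++ [ 0 ]) ++ (w1 ++ [ 1 ])) sa01 →
    (i ℓ : ℕ) → 2 ≤ i → i ≤ length (w0 ++ [ 0 ]) + length (w1 ++ [ 1 ]) →
    LCP ((w0 ++ [ 0 ]) ++ (w1 ++ [ 1 ])) sa01 i ≡ ℓ →
    (h : ℕ) → suc ℓ ≤ h →
    Bafter (w0 ++ [ 0 ]) (w1 ++ [ 1 ]) sa0 sa1 h i ≡ suc ℓ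
corollary1 w0 w1 w0≥2 w1≥2 sa0 sa1 sa01 isSA0 isSA1 isSA01 i ℓ 2≤i i≤N LCP≡ℓ h ℓ<h =
  subst (λ l → Bafter (w0 ++ [ 0 ]) (w1 ++ [ 1 ]) sa0 sa1 h i ≡ suc l) LCP≡ℓ
        (B-after-phase h i 2≤i i≤N (subst (_< h) (sym LCP≡ℓ) ℓ<h))
  where open Gap.WithSuffixArrays w0 w1 w0≥2 w1≥2 sa0 sa1 sa01 isSA0 isSA1 isSA01
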